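{- Let $\mathcal S=(a_i)_{i\ge1}$ be an infinite sequence of elementary foldings ($a_i\in\{+,-\}$) and let $P_{\mathcal S}$ be the corresponding folding pattern. Then for every $k\in\mathbb N$ the coloring of the unit edges lying in the layer $\mathcal L_k$ is determined by $a_k$ alone, as follows. If $k$ is odd and $a_k=+$, or $k$ is even and $a_k=-$, then all unit edges on the boundaries of positive triangles of $\mathcal L_k$ are red and all unit edges on the boundaries of negative triangles of $\mathcal L_k$ are blue. If $k$ is odd and $a_k=-$, or $k$ is even and $a_k=+$, then all unit edges on the boundaries of positive triangles of $\mathcal L_k$ are blue and all unit edges on the boundaries of negative triangles of $\mathcal L_k$ are red.
   Context: Grid: let $\xi_1=(0,-2\sqrt3)$ and let $\xi_2,\xi_3$ be its counterclockwise rotations by $2\pi/3$ and $4\pi/3$. For $i\in\{1,2,3\}$, $n\in\mathbb Z$ put $\ell_{i,n}=\{x\in\mathbb R^2:(x,\xi_i)=3n+1\}$ (standard inner product). The union $\mathcal L$ of all $\ell_{i,n}$ is a triangular grid whose smallest triangles (unit triangles) are regular of side $1$; unit edges are the sides of unit triangles. A regular triangle with sides on grid lines is positive if its vertex opposite its horizontal side lies above that side, and negative otherwise. $O$ is the origin and $T_0$ is the positive unit triangle centered at $O$ (bounded by $\ell_{1,0},\ell_{2,0},\ell_{3,0}$); $(-2)^kT_0$ denotes its image under the homothety with center $O$ and ratio $(-2)^k$, a grid triangle of side $2^k$, positive iff $k$ is even. Folding patterns: an elementary folding folds a paper regular triangle of side $2a$ along its three midsegments onto its central (medial) triangle of side $a$;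 it is a folding up ($+$) if all three folds go through the upper half-space of $\mathbb R^3$ and a folding down ($-$) if all three go through the lower half-space. When unfolded, the fold lines of a folding up become valleys and those of a folding down become peaks. For a finite sequence $\mathcal F=(a_1,\dots,a_k)$, take the paper triangle $(-2)^kT_0$, perform $a_k$ first (folding it onto $(-2)^{k-1}T_0$), then $a_{k-1}$, …, and finally $a_1$ (ending on $T_0$ with $4^k$ layers), then unfold completely; every unit edge in the interior of $(-2)^kT_0$ is then a valley or a peak. The folding pattern $P_{\mathcal F}$ colors valleys red and peaks blue. For an infinite sequence $\mathcal S=(a_i)_{i\ge1}$, $P_{\mathcal S}$ is the coloring of all unit edges of $\mathcal L$ in which each edge gets its color in $P_{(a_1,\dots,a_k)}$ for any $k$ such that the edge lies in the interior of $(-2)^kT_0$ (this does not depend on $k$). Layers: for $k\in\mathbb N$ let $\Lambda_k$ be the set of integers $n$ such that the largest power of $2$ dividing $3n+1$ is $2^{k-1}$, and let $\mathcal L_k=\bigcup_{i=1}^3\bigcup_{n\in\Lambda_k}\ell_{i,n}$. The lines of $\mathcal L_k$ cut the plane into regular triangles and regular hexagons of side $2^{k-1}$; these triangles are called the positive/negative triangles of the layer $\mathcal L_k$ according to their orientation. Every unit edge of $\mathcal L$ lies in exactly one layer. -}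

module Defs where

open import Data.Integer as ℤ using (ℤ; +_; _+_; _*_; -_; _-_; _<_; _≤_; _<?_)
open import Data.Integer.Divisibility using (_∣_)
open import Data.Nat as ℕ using (ℕ; zero; suc; _^_; _∸_)
open import Data.Fin as Fin using (Fin; zero; suc)
open import Data.Product using (_×_; ∃)
open import Data.Bool using (Bool; true; false; not; if_then_else_)
open import Data.Maybe using (Maybe; just; nothing)
open import Relation.Nullary using (¬_; yes; no; does)
open import Relation.Binary.PropositionalEquality using (_≡_; _≢_)

-- A point x of the plane is described by its "u-coordinates"
--   u_i(x) = (x , ξ_i),  i ∈ Fin 3  (Fin index 0,1,2 ↔ paper's 1,2,3),
-- which satisfy u_1 + u_2 + u_3 = 0 (since ξ_1+ξ_2+ξ_3 = 0) and determine x.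
-- All points we need (grid vertices, centroids of unit triangles) have
-- integer u-coordinates.  The line ℓ_{i,m} is { u_i = 3m+1 }.

Pt : Set
Pt = Fin 3 → ℤ

lvl : ℤ → ℤ
lvl m = + 3 * m + + 1

data Fold : Set where
  up down : Fold      -- "+" and "-"

data Colour : Set where
  red blue : Colour   -- valley, peak

negTwoPow : ℕ → ℤ
negTwoPow zero = + 1
negTwoPow (suc j) = - + 2 * negTwoPow j

-- The grid triangle (-2)^j T_0 is { x : (-2)^{-j} u_i(x) ≤ 1 for all i },
-- i.e. with s = (-2)^j : { u_i * s ≤ s * s for all i }.
-- A unit triangle lies in (-2)^j T_0 iff its centroid c satisfies
-- c_i * s < s * s for all i (strict inequality; centroids never lie on grid lines).
InsideCentroid : ℕ → Pt → Set
InsideCentroid j c = ∀ i → c i * negTwoPow j < negTwoPow j * negTwoPow j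

reflect : Fin 3 → ℤ → Pt → Pt
reflect i t p j = if does (j Fin.≟ i) then (+ 2 * t - p i) else (p j + p i - t)

-- Elementary folding of (-2)^{j+1} T_0 onto its medial triangle (-2)^j T_0,
-- applied to a unit triangle given by its centroid p (lying in (-2)^{j+1} T_0):
-- 'nothing' if p lies in the central triangle (-2)^j T_0 (which stays put),
-- 'just i' if p lies in the corner cut off by the line { u_i = (-2)^j },
-- which is reflected in that line (the midsegment).
piece : ℕ → Pt → Maybe (Fin 3)
piece j p = pick (p zero) (p (suc zero)) (p (suc (suc zero)))
  where
  s = negTwoPow j
  out : ℤ → Bool
  out x = does (s * s <? x * s)
  pick : ℤ → ℤ → ℤ → Maybe (Fin 3)
  pick x y z = if out x then just zero else
               if out y then just (suc zero) else
               if out z then just (suc (suc zero)) else nothing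

-- Colour of a crease created by a folding of type f, where the paper layer
-- being folded is face-up (π = false) or face-down (π = true) relative to
-- its original position.
foldColour : Fold → Bool → Colour
foldColour up false = red
foldColour up true = blue
foldColour down false = blue
foldColour down true = red

-- crease a j p q π :
-- p, q are the current positions (centroids) of two unit triangles of paper
-- adjacent along a unit edge e; they have been moved so far by the same
-- isometry, whose orientation parity is π; the foldings a_j, a_{j-1}, …, a_1
-- remain to be performed.  The crease at e is created by the first folding
-- that moves p and q differently (one stays / they are in different pieces).
-- 'nothing' means no crease is ever created.
crease : (ℕ → Fold) → ℕ → Pt → Pt → Bool → Maybe Colour
crease a zero p q π = nothing
crease a (suc j) p q π = go (piece j p) (piece j q)
  where
  creased : Maybe Colour
  creased = just (foldColour (a (suc j)) π)
  go : Maybe (Fin 3) → Maybe (Fin 3) → Maybe Colour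
  go nothing nothing = crease a j p q π
  go nothing (just _) = creased
  go (just _) nothing = creased
  go (just i) (just i') with i Fin.≟ i'
  ... | yes _ = crease a j (reflect i (negTwoPow j) p) (reflect i (negTwoPow j) q) (not π)
  ... | no _ = creased

-- Every unit edge is a side of exactly one positive unit triangle
--   P(n) = { u_t ≤ 3 n_t + 1 for all t },   n_1 + n_2 + n_3 = 0 ;
-- the edge (n , i) is the side of P(n) on the line ℓ_{i, n_i}.

record UnitEdge : Set where
  field
    n    : Fin 3 → ℤ
    sum0 : n zero + n (suc zero) + n (suc (suc zero)) ≡ + 0
    dir  : Fin 3
open UnitEdge public

posCentroid : UnitEdge → Pt
posCentroid e t = + 3 * n e t

-- centroid of the negative unit triangle across the edge:
-- { u_i ≥ 3n_i+1 , u_t ≥ 3n_t - 2 (t ≠ i) }, centroid u_i = 3n_i+2, u_t = 3n_t - 1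
negCentroid : UnitEdge → Pt
negCentroid e t = if does (t Fin.≟ dir e) then + 3 * n e t + + 2 else + 3 * n e t - + 1

-- vertex of P(n) opposite to its side on line t: u_t = 3n_t - 2, u_x = 3n_x + 1 (x ≠ t)
vertexP : UnitEdge → Fin 3 → Pt
vertexP e t x = if does (x Fin.≟ t) then + 3 * n e x - + 2 else lvl (n e x)

-- the endpoints of the edge (n , i) are the vertices vertexP e t with t ≠ i

InteriorEdge : ℕ → UnitEdge → Set
InteriorEdge K e = InsideCentroid K (posCentroid e) × InsideCentroid K (negCentroid e)

-- Colour of the edge e in the folding pattern P_{(a_1,…,a_K)}
-- (meaningful when e is interior to (-2)^K T_0).
colourIn : (ℕ → Fold) → ℕ → UnitEdge → Maybe Colour
colourIn a K e = crease a K (posCentroid e) (negCentroid e) false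

Λ : ℕ → ℤ → Set
Λ k m = (+ (2 ^ (k ∸ 1)) ∣ lvl m) × ¬ (+ (2 ^ k) ∣ lvl m)

Odd Even : ℕ → Set
Odd k = ∃ λ m → k ≡ suc (2 ℕ.* m)
Even k = ∃ λ m → k ≡ 2 ℕ.* m

sum3 : Pt → ℤ
sum3 c = c zero + c (suc zero) + c (suc (suc zero))

-- A positive triangle of the layer L_k is a region { u_t ≤ c_t for all t }
-- (c_1+c_2+c_3 > 0) whose three sides lie on lines of L_k and whose interior
-- meets no line of L_k.  (On it, u_t ranges over [c_t - S , c_t], S = Σ c.)
record PosTriangle (k : ℕ) (c : Pt) : Set where
  field
    sides  : ∀ t → ∃ λ m → Λ k m × c t ≡ lvl m
    nondeg : + 0 < sum3 c
    face   : ∀ t m → Λ k m → ¬ ((c t - sum3 c < lvl m) × (lvl m < c t))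

-- A negative triangle of L_k: { u_t ≥ c_t for all t } with c_1+c_2+c_3 < 0
-- (u_t ranges over [c_t , c_t - S]).
record NegTriangle (k : ℕ) (c : Pt) : Set where
  field
    sides  : ∀ t → ∃ λ m → Λ k m × c t ≡ lvl m
    nondeg : sum3 c < + 0
    face   : ∀ t m → Λ k m → ¬ ((c t < lvl m) × (lvl m < c t - sum3 c))

OnBoundaryPos : Pt → UnitEdge → Set
OnBoundaryPos c e = (c (dir e) ≡ lvl (n e (dir e))) ×
                    (∀ t → t ≢ dir e → ∀ x → vertexP e t x ≤ c x)

OnBoundaryNeg : Pt → UnitEdge → Set
OnBoundaryNeg c e = (c (dir e) ≡ lvl (n e (dir e))) ×
                    (∀ t → t ≢ dir e → ∀ x → c x ≤ vertexP e t x)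

OnPosTriOfLayer OnNegTriOfLayer : ℕ → UnitEdge → Set
OnPosTriOfLayer k e = ∃ λ c → PosTriangle k c × OnBoundaryPos c e
OnNegTriOfLayer k e = ∃ λ c → NegTriangle k c × OnBoundaryNeg c e

-- "In P_S (S = (a_i)), edges on positive triangles of L_k have colour cp and
-- edges on negative triangles of L_k have colour cn":
-- the colour of an edge in P_S is its colour in P_{(a_1..a_K)} for any K
-- such that the edge is interior to (-2)^K T_0.
LayerColoured : (ℕ → Fold) → ℕ → Colour → Colour → Set
LayerColoured a k cp cn =
  (∀ K e → InteriorEdge K e → OnPosTriOfLayer k e → colourIn a K e ≡ just cp) ×
  (∀ K e → InteriorEdge K e → OnNegTriOfLayer k e → colourIn a K e ≡ just cn)

-- Follow a unit edge of the layer L_k, k = e + 1, together with the layer triangle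
-- it bounds, through the foldings a_K, ..., a_1.  Put s = (-2)^e: the lines of L_k
-- are u_t = s(6z+1), while the fold lines of a_(j+1), j ≥ k, are u_t = (-2)^j ≡ 4s
-- (mod 6s).  So a folding before a_k never separates the two unit triangles on either
-- side of the edge: both stay put or both are reflected, and a reflection flips both
-- the side of the paper facing up and the orientation of the layer triangle.  When
-- a_k is reached, the edge lies in (-2)^k T₀ on one of its midsegments u_d = s and its
-- triangle has become the central triangle (-2)^e T₀, so a_k creases it with colour
-- given by a_k and the face of the paper, i.e. by a_k and the original orientation of
-- the layer triangle relative to (-2)^e T₀.  Positive triangles of L_k have that
-- orientation exactly when s > 0, i.e. when k is odd.

module Submission where

open import Defs
open import Data.Bool using (Bool; true; false; not; _xor_; if_then_else_)
import Data.Bool.Properties as Boolₚ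
open import Data.Empty using (⊥; ⊥-elim)
open import Data.Fin as Fin using (Fin; zero; suc)
open import Data.Integer as ℤ using (ℤ; +_; -[1+_]; _+_; _*_; -_; _-_; _<_; _<?_; +<+; -<+; _%ℕ_; _/ℕ_)
open import Data.Integer.DivMod using (a≡a%ℕn+[a/ℕn]*n; n%ℕd<d)
import Data.Integer.Divisibility as Unsigned
open import Data.Integer.Divisibility.Signed using (_∣_; divides; ∣ᵤ⇒∣; ∣⇒∣ᵤ; ∣-trans; m∣∣m∣; ∣m∣∣m)
import Data.Integer.Properties as ℤP
open import Algebra.Properties.CommutativeSemigroup ℤP.+-commutativeSemigroup using (xy∙z≈xz∙y)
open import Data.Integer.Tactic.RingSolver using (solve-∀)
open import Data.Maybe using (Maybe; just; nothing)
open import Data.Nat as ℕ using (ℕ; zero; suc; _≤_)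
import Data.Nat.Divisibility as ℕD
import Data.Nat.Properties as ℕP
open import Data.Product using (_×_; _,_; ∃; proj₁; proj₂; map)
open import Data.Sum using (_⊎_; inj₁; inj₂)
open import Data.Unit using (⊤; tt)
open import Function using (_∘_)
open import Relation.Binary.Definitions using (tri<; tri≈; tri>)
open import Relation.Binary.PropositionalEquality
open import Relation.Nullary using (¬_; yes; no; does)
open import Relation.Nullary.Decidable using (dec-true; dec-false)

<-by-gap : ∀ {a b} d → + 0 < d → b ≡ a + d → a < b
<-by-gap {a} {b} d 0<d b≡a+d = subst (_< b) (ℤP.+-identityʳ a) (subst (a + + 0 <_) (sym b≡a+d) (ℤP.+-monoʳ-< a 0<d))

≤-by-gap : ∀ {a b} d → + 0 ℤ.≤ d → b ≡ a + d → a ℤ.≤ b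
≤-by-gap {a} {b} d 0≤d b≡a+d = subst (ℤ._≤ b) (ℤP.+-identityʳ a) (subst (a + + 0 ℤ.≤_) (sym b≡a+d) (ℤP.+-monoʳ-≤ a 0≤d))

i<j⇒0<j-i : ∀ {i j} → i < j → + 0 < j - i
i<j⇒0<j-i {i} {j} i<j = subst (_< j - i) (ℤP.+-inverseʳ i) (ℤP.+-monoˡ-< (- i) i<j)

≤⇒<+1 : ∀ {a b} → a ℤ.≤ b → a < b + + 1
≤⇒<+1 {a} {b} a≤b = <-by-gap ((b - a) + + 1) (ℤP.+-mono-≤-< (ℤP.i≤j⇒0≤j-i a≤b) (+<+ (ℕ.s≤s ℕ.z≤n))) (gap a b)
  where
  gap : ∀ a b → b + + 1 ≡ a + ((b - a) + + 1)
  gap = solve-∀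

<⇒+1≤ : ∀ {a b} → a < b → a + + 1 ℤ.≤ b
<⇒+1≤ {a} {b} a<b = subst (ℤ._≤ b) (ℤP.+-comm (+ 1) a) (ℤP.i<j⇒suc[i]≤j a<b)

<+1⇒≤ : ∀ {a b} → a < b + + 1 → a ℤ.≤ b
<+1⇒≤ {a} {b} a<b+1 = ≤-by-gap ((b + + 1) - (a + + 1)) (ℤP.i≤j⇒0≤j-i (<⇒+1≤ a<b+1)) (gap a b)
  where
  gap : ∀ a b → b ≡ a + ((b + + 1) - (a + + 1))
  gap = solve-∀

0<⇒0≤-1 : ∀ {i} → + 0 < i → + 0 ℤ.≤ i - + 1
0<⇒0≤-1 0<i = ℤP.i≤j⇒0≤j-i (ℤP.i<j⇒suc[i]≤j 0<i)

<0⇒0≤-i-1 : ∀ {i} → i < + 0 → + 0 ℤ.≤ - i - + 1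
<0⇒0≤-i-1 {i} i<0 = 0<⇒0≤-1 (ℤP.neg-mono-< i<0)

0≤n* : ∀ n {i} → + 0 ℤ.≤ i → + 0 ℤ.≤ + n * i
0≤n* n {i} 0≤i = subst (ℤ._≤ + n * i) (ℤP.*-zeroʳ (+ n)) (ℤP.*-monoˡ-≤-nonNeg (+ n) 0≤i)

0<6i+3 : ∀ {i} → + 0 ℤ.≤ i → + 0 < + 6 * i + + 3
0<6i+3 0≤i = ℤP.+-mono-≤-< (0≤n* 6 0≤i) (+<+ (ℕ.s≤s ℕ.z≤n))

0≮-[1+n] : ∀ {n} → ¬ (+ 0 < -[1+ n ])
0≮-[1+n] ()

6z+3>0∧3-6z>0⇒z≡0 : ∀ z → + 0 < + 6 * z + + 3 → + 0 < + 3 - + 6 * z → z ≡ + 0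
6z+3>0∧3-6z>0⇒z≡0 z lower upper with ℤP.<-cmp z (+ 0)
... | tri≈ _ z≡0 _ = z≡0
... | tri< z<0 _ _ = ⊥-elim (0≮-[1+n] (subst (+ 0 <_) (sum z) (ℤP.+-mono-<-≤ lower (0≤n* 6 (<0⇒0≤-i-1 z<0)))))
  where
  sum : ∀ z → (+ 6 * z + + 3) + + 6 * (- z - + 1) ≡ - + 3
  sum = solve-∀
... | tri> _ _ 0<z = ⊥-elim (0≮-[1+n] (subst (+ 0 <_) (sum z) (ℤP.+-mono-<-≤ upper (0≤n* 6 (0<⇒0≤-1 0<z)))))
  where
  sum : ∀ z → (+ 3 - + 6 * z) + + 6 * (z - + 1) ≡ - + 3
  sum = solve-∀

*-pos-pos : ∀ {a b} → + 0 < a → + 0 < b → + 0 < a * b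
*-pos-pos {a} {b} 0<a 0<b = subst (_< a * b) (ℤP.*-zeroʳ a) (ℤP.*-monoˡ-<-pos a {{ℤ.positive 0<a}} 0<b)

*-neg-neg : ∀ {a b} → a < + 0 → b < + 0 → + 0 < a * b
*-neg-neg {a} {b} a<0 b<0 = subst (_< a * b) (ℤP.*-zeroʳ a) (ℤP.*-monoˡ-<-neg a {{ℤ.negative a<0}} b<0)

*-neg-pos : ∀ {a b} → a < + 0 → + 0 < b → a * b < + 0
*-neg-pos {a} {b} a<0 0<b = subst (a * b <_) (ℤP.*-zeroʳ a) (ℤP.*-monoˡ-<-neg a {{ℤ.negative a<0}} 0<b)

*-cancelʳ-pos : ∀ {a k} → + 0 < k → + 0 < a * k → + 0 < a
*-cancelʳ-pos {a} {k} 0<k 0<ak = ℤP.*-cancelʳ-<-nonNeg k {{ℤ.nonNegative (ℤP.<⇒≤ 0<k)}} (subst (_< a * k) (sym (ℤP.*-zeroˡ k)) 0<ak)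

*-cancelˡ-pos : ∀ n {a} → + 0 < + n * a → + 0 < a
*-cancelˡ-pos n {a} 0<na = ℤP.*-cancelˡ-<-nonNeg (+ n) (subst (_< + n * a) (sym (ℤP.*-zeroʳ (+ n))) 0<na)

n*a≢r : ∀ n r a → 0 ℕ.< r → r ℕ.< n → + n * a ≢ + r
n*a≢r n r a 0<r r<n n*a≡r = ℕP.<⇒≱ r<n (ℕD.∣⇒≤ {{ℕ.>-nonZero 0<r}} n∣r)
  where
  n∣r : n ℕD.∣ r
  n∣r = ℕD.divides ℤ.∣ a ∣ (trans (sym (cong ℤ.∣_∣ n*a≡r)) (trans (ℤP.abs-* (+ n) a) (ℕP.*-comm n ℤ.∣ a ∣)))

x+y+z≡0⇒z≡-x-y : ∀ {x y z} → x + y + z ≡ + 0 → z ≡ - x - y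
x+y+z≡0⇒z≡-x-y {x} {y} {z} sum≡0 = trans (isolate x y z) (trans (cong (_+ (- x - y)) sum≡0) (ℤP.+-identityˡ (- x - y)))
  where
  isolate : ∀ x y z → z ≡ (x + y + z) + (- x - y)
  isolate = solve-∀

x+y+z≡0⇒y+x-t≡-t-z : ∀ {x y z} t → x + y + z ≡ + 0 → y + x - t ≡ - t - z
x+y+z≡0⇒y+x-t≡-t-z {x} {y} {z} t sum≡0 = trans (shift x y z t) (trans (cong (_+ (- t - z)) sum≡0) (ℤP.+-identityˡ (- t - z)))
  where
  shift : ∀ x y z t → y + x - t ≡ (x + y + z) + (- t - z)
  shift = solve-∀

≤⇒∃suc+ : ∀ {e K} → suc e ≤ K → ∃ λ r → suc (r ℕ.+ e) ≡ K
≤⇒∃suc+ {e} {K} e<K = K ℕ.∸ suc e , trans (sym (ℕP.+-suc (K ℕ.∸ suc e) e)) (ℕP.m∸n+n≡m e<K)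

Sign : ℤ → Set
Sign s = (+ 0 < s) ⊎ (s < + 0)

Sign-neg : ∀ {s} → Sign s → Sign (- s)
Sign-neg (inj₁ 0<s) = inj₂ (ℤP.neg-mono-< 0<s)
Sign-neg (inj₂ s<0) = inj₁ (ℤP.neg-mono-< s<0)

0<s*s : ∀ {s} → Sign s → + 0 < s * s
0<s*s (inj₁ 0<s) = *-pos-pos 0<s 0<s
0<s*s (inj₂ s<0) = *-neg-neg s<0 s<0

-2<0 : - + 2 < + 0
-2<0 = -<+ {1} {0}

negTwoPow-sign : ∀ j → Sign (negTwoPow j)
negTwoPow-sign zero = inj₁ (+<+ (ℕ.s≤s ℕ.z≤n))
negTwoPow-sign (suc j) with negTwoPow-sign j
... | inj₁ 0<s = inj₂ (*-neg-pos -2<0 0<s)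
... | inj₂ s<0 = inj₁ (*-neg-neg -2<0 s<0)

negTwoPow≢0 : ∀ j → negTwoPow j ≢ + 0
negTwoPow≢0 j s≡0 with negTwoPow-sign j
... | inj₁ 0<s = ℤP.<-irrefl (sym s≡0) 0<s
... | inj₂ s<0 = ℤP.<-irrefl s≡0 s<0

negTwoPow-even : ∀ m → + 0 < negTwoPow (2 ℕ.* m)
negTwoPow-even zero = +<+ (ℕ.s≤s ℕ.z≤n)
negTwoPow-even (suc m) rewrite ℕP.+-suc m (m ℕ.+ 0) = *-neg-neg -2<0 (*-neg-pos -2<0 (negTwoPow-even m))

negTwoPow-odd : ∀ m → negTwoPow (suc (2 ℕ.* m)) < + 0
negTwoPow-odd m = *-neg-pos -2<0 (negTwoPow-even m)

negTwoPow-+ : ∀ r e → negTwoPow (r ℕ.+ e) ≡ negTwoPow r * negTwoPow e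
negTwoPow-+ zero e = sym (ℤP.*-identityˡ (negTwoPow e))
negTwoPow-+ (suc r) e = trans (cong (- + 2 *_) (negTwoPow-+ r e)) (sym (ℤP.*-assoc (- + 2) (negTwoPow r) (negTwoPow e)))

negTwoPow-level : ∀ j → ∃ λ m → negTwoPow j ≡ lvl m
negTwoPow-level zero = + 0 , refl
negTwoPow-level (suc j) with negTwoPow-level j
... | m , s≡lvl = - + 2 * m - + 1 , trans (cong (- + 2 *_) s≡lvl) (double m)
  where
  double : ∀ m → - + 2 * (+ 3 * m + + 1) ≡ + 3 * (- + 2 * m - + 1) + + 1
  double = solve-∀

negTwoPow-suc≡6w+4 : ∀ j → ∃ λ w → negTwoPow (suc j) ≡ + 6 * w + + 4
negTwoPow-suc≡6w+4 zero = - + 1 , refl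
negTwoPow-suc≡6w+4 (suc j) with negTwoPow-suc≡6w+4 j
... | w , t≡6w+4 = - + 2 * w - + 2 , trans (cong (- + 2 *_) t≡6w+4) (double w)
  where
  double : ∀ w → - + 2 * (+ 6 * w + + 4) ≡ + 6 * (- + 2 * w - + 2) + + 4
  double = solve-∀

∣negTwoPow∣ : ∀ j → ℤ.∣ negTwoPow j ∣ ≡ 2 ℕ.^ j
∣negTwoPow∣ zero = refl
∣negTwoPow∣ (suc j) = trans (ℤP.abs-* (- + 2) (negTwoPow j)) (cong (2 ℕ.*_) (∣negTwoPow∣ j))

2^∣⇒negTwoPow∣ : ∀ j {x} → + (2 ℕ.^ j) Unsigned.∣ x → negTwoPow j ∣ x
2^∣⇒negTwoPow∣ j {x} 2^∣x = ∣-trans m∣∣m∣ (subst (_∣ x) (sym (cong +_ (∣negTwoPow∣ j))) (∣ᵤ⇒∣ 2^∣x))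

negTwoPow∣⇒2^∣ : ∀ j {x} → negTwoPow j ∣ x → + (2 ℕ.^ j) Unsigned.∣ x
negTwoPow∣⇒2^∣ j {x} s∣x = ∣⇒∣ᵤ (subst (_∣ x) (cong +_ (∣negTwoPow∣ j)) (∣-trans ∣m∣∣m s∣x))

lvl≢3* : ∀ m k → lvl m ≢ + 3 * k
lvl≢3* m k eq = n*a≢r 3 1 (k - m) (ℕ.s≤s ℕ.z≤n) (ℕ.s≤s (ℕ.s≤s ℕ.z≤n))
  (trans (expand k m) (trans (cong (λ u → u - lvl m + + 1) (sym eq)) (cancel (lvl m))))
  where
  expand : ∀ k m → + 3 * (k - m) ≡ + 3 * k - (+ 3 * m + + 1) + + 1
  expand = solve-∀
  cancel : ∀ x → x - x + + 1 ≡ + 1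
  cancel = solve-∀

lvl≢3*+2 : ∀ m k → lvl m ≢ + 3 * k + + 2
lvl≢3*+2 m k eq = n*a≢r 3 1 (m - k) (ℕ.s≤s ℕ.z≤n) (ℕ.s≤s (ℕ.s≤s ℕ.z≤n))
  (trans (expand m k) (trans (cong (λ u → u - (+ 3 * k + + 2) + + 1) eq) (cancel (+ 3 * k + + 2))))
  where
  expand : ∀ m k → + 3 * (m - k) ≡ (+ 3 * m + + 1) - (+ 3 * k + + 2) + + 1
  expand = solve-∀
  cancel : ∀ x → x - x + + 1 ≡ + 1
  cancel = solve-∀

offGrid⇒≢level : ∀ {v t} → (∀ m → v ≢ lvl m) → (∃ λ m → t ≡ lvl m) → v ≢ t
offGrid⇒≢level offGrid (m , t≡) v≡t = offGrid m (trans v≡t t≡)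

OnLayer : ℤ → ℤ → Set
OnLayer s x = ∃ λ z → x ≡ s * (+ 6 * z + + 1)

next : Fin 3 → Fin 3
next zero = suc zero
next (suc zero) = suc (suc zero)
next (suc (suc zero)) = zero

next≢ : ∀ d → next d ≢ d
next≢ zero ()
next≢ (suc zero) ()
next≢ (suc (suc zero)) ()

sum3-cong : ∀ {u v : Pt} → (∀ x → u x ≡ v x) → sum3 u ≡ sum3 v
sum3-cong u≗v = cong₂ _+_ (cong₂ _+_ (u≗v zero) (u≗v (suc zero))) (u≗v (suc (suc zero)))

swapOthers : Fin 3 → Fin 3 → Fin 3
swapOthers zero zero = zero
swapOthers zero (suc zero) = suc (suc zero)
swapOthers zero (suc (suc zero)) = suc zero
swapOthers (suc zero) zero = suc (suc zero)
swapOthers (suc zero) (suc zero) = suc zero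
swapOthers (suc zero) (suc (suc zero)) = zero
swapOthers (suc (suc zero)) zero = suc zero
swapOthers (suc (suc zero)) (suc zero) = zero
swapOthers (suc (suc zero)) (suc (suc zero)) = suc (suc zero)

swapOthers-involutive : ∀ i x → swapOthers i (swapOthers i x) ≡ x
swapOthers-involutive zero zero = refl
swapOthers-involutive zero (suc zero) = refl
swapOthers-involutive zero (suc (suc zero)) = refl
swapOthers-involutive (suc zero) zero = refl
swapOthers-involutive (suc zero) (suc zero) = refl
swapOthers-involutive (suc zero) (suc (suc zero)) = refl
swapOthers-involutive (suc (suc zero)) zero = refl
swapOthers-involutive (suc (suc zero)) (suc zero) = refl
swapOthers-involutive (suc (suc zero)) (suc (suc zero)) = refl

swapOthers-≢ : ∀ i x d → x ≢ swapOthers i d → swapOthers i x ≢ d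
swapOthers-≢ i x d x≢ eq = x≢ (trans (sym (swapOthers-involutive i x)) (cong (swapOthers i) eq))

swapOthers-fixes : ∀ i → swapOthers i i ≡ i
swapOthers-fixes zero = refl
swapOthers-fixes (suc zero) = refl
swapOthers-fixes (suc (suc zero)) = refl

swapOthers-moves : ∀ d x → x ≢ d → swapOthers d x ≢ x
swapOthers-moves zero zero x≢d = ⊥-elim (x≢d refl)
swapOthers-moves zero (suc zero) _ ()
swapOthers-moves zero (suc (suc zero)) _ ()
swapOthers-moves (suc zero) zero _ ()
swapOthers-moves (suc zero) (suc zero) x≢d = ⊥-elim (x≢d refl)
swapOthers-moves (suc zero) (suc (suc zero)) _ ()
swapOthers-moves (suc (suc zero)) zero _ ()
swapOthers-moves (suc (suc zero)) (suc zero) _ ()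
swapOthers-moves (suc (suc zero)) (suc (suc zero)) x≢d = ⊥-elim (x≢d refl)

swapOthers-≢self : ∀ d x → x ≢ d → swapOthers d x ≢ d
swapOthers-≢self d x x≢d = swapOthers-≢ d x d (subst (x ≢_) (sym (swapOthers-fixes d)) x≢d)

sum3-via-swap : ∀ (v : Pt) d x → x ≢ d → sum3 v ≡ v d + v x + v (swapOthers d x)
sum3-via-swap v zero zero x≢d = ⊥-elim (x≢d refl)
sum3-via-swap v zero (suc zero) _ = refl
sum3-via-swap v zero (suc (suc zero)) _ = xy∙z≈xz∙y (v zero) (v (suc zero)) (v (suc (suc zero)))
sum3-via-swap v (suc zero) zero _ = cong (_+ v (suc (suc zero))) (ℤP.+-comm (v zero) (v (suc zero)))
sum3-via-swap v (suc zero) (suc zero) x≢d = ⊥-elim (x≢d refl)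
sum3-via-swap v (suc zero) (suc (suc zero)) _ = rotate (v zero) (v (suc zero)) (v (suc (suc zero)))
  where
  rotate : ∀ a b c → a + b + c ≡ b + c + a
  rotate = solve-∀
sum3-via-swap v (suc (suc zero)) zero _ = rotate (v zero) (v (suc zero)) (v (suc (suc zero)))
  where
  rotate : ∀ a b c → a + b + c ≡ c + a + b
  rotate = solve-∀
sum3-via-swap v (suc (suc zero)) (suc zero) _ = reverse (v zero) (v (suc zero)) (v (suc (suc zero)))
  where
  reverse : ∀ a b c → a + b + c ≡ c + b + a
  reverse = solve-∀
sum3-via-swap v (suc (suc zero)) (suc (suc zero)) x≢d = ⊥-elim (x≢d refl)

sum3≡0⇒swapOthers : ∀ (v : Pt) d x → x ≢ d → sum3 v ≡ + 0 → v (swapOthers d x) ≡ - v d - v x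
sum3≡0⇒swapOthers v d x x≢d Σ≡0 = x+y+z≡0⇒z≡-x-y {v d} {v x} (trans (sym (sum3-via-swap v d x x≢d)) Σ≡0)

-- On points with sum3 ≡ 0, reflect i t agrees with mirror i t (reflect≗mirror):
-- negate, exchange the two coordinates other than i, and shift.
mirrorShift : Fin 3 → ℤ → Fin 3 → ℤ
mirrorShift i t x = if does (x Fin.≟ i) then + 2 * t else - t

mirror : Fin 3 → ℤ → Pt → Pt
mirror i t v x = mirrorShift i t x - v (swapOthers i x)

mirrorShift-cases : ∀ i t x → (mirrorShift i t x ≡ + 2 * t × swapOthers i x ≡ i) ⊎ mirrorShift i t x ≡ - t
mirrorShift-cases i t x with x Fin.≟ i
... | yes refl = inj₁ (refl , swapOthers-fixes x)
... | no _ = inj₂ refl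

sum3-mirror : ∀ i t v → sum3 (mirror i t v) ≡ - sum3 v
sum3-mirror zero t v = negate t (v zero) (v (suc zero)) (v (suc (suc zero)))
  where
  negate : ∀ t a b c → (+ 2 * t - a) + (- t - c) + (- t - b) ≡ - (a + b + c)
  negate = solve-∀
sum3-mirror (suc zero) t v = negate t (v zero) (v (suc zero)) (v (suc (suc zero)))
  where
  negate : ∀ t a b c → (- t - c) + (+ 2 * t - b) + (- t - a) ≡ - (a + b + c)
  negate = solve-∀
sum3-mirror (suc (suc zero)) t v = negate t (v zero) (v (suc zero)) (v (suc (suc zero)))
  where
  negate : ∀ t a b c → (- t - b) + (- t - a) + (+ 2 * t - c) ≡ - (a + b + c)
  negate = solve-∀

offAxis : ∀ i {x} t (v : Pt) → x ≢ i → sum3 v ≡ + 0 → v x + v i - t ≡ - t - v (swapOthers i x)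
offAxis i {x} t v x≢i Σ≡0 = x+y+z≡0⇒y+x-t≡-t-z {v i} {v x} t (trans (sym (sum3-via-swap v i x x≢i)) Σ≡0)

reflect≗mirror : ∀ i t v → sum3 v ≡ + 0 → ∀ x → reflect i t v x ≡ mirror i t v x
reflect≗mirror zero t v Σ≡0 zero = refl
reflect≗mirror zero t v Σ≡0 (suc zero) = offAxis zero t v (λ ()) Σ≡0
reflect≗mirror zero t v Σ≡0 (suc (suc zero)) = offAxis zero t v (λ ()) Σ≡0
reflect≗mirror (suc zero) t v Σ≡0 zero = offAxis (suc zero) t v (λ ()) Σ≡0
reflect≗mirror (suc zero) t v Σ≡0 (suc zero) = refl
reflect≗mirror (suc zero) t v Σ≡0 (suc (suc zero)) = offAxis (suc zero) t v (λ ()) Σ≡0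
reflect≗mirror (suc (suc zero)) t v Σ≡0 zero = offAxis (suc (suc zero)) t v (λ ()) Σ≡0
reflect≗mirror (suc (suc zero)) t v Σ≡0 (suc zero) = offAxis (suc (suc zero)) t v (λ ()) Σ≡0
reflect≗mirror (suc (suc zero)) t v Σ≡0 (suc (suc zero)) = refl

negCentroid-dir : ∀ ed → negCentroid ed (dir ed) ≡ + 3 * n ed (dir ed) + + 2
negCentroid-dir ed with dir ed Fin.≟ dir ed
... | yes _ = refl
... | no d≢d = ⊥-elim (d≢d refl)

negCentroid-other : ∀ ed x → x ≢ dir ed → negCentroid ed x ≡ + 3 * n ed x - + 1
negCentroid-other ed x x≢d with x Fin.≟ dir ed
... | yes x≡d = ⊥-elim (x≢d x≡d)
... | no _ = refl

vertexP-own : ∀ ed x → vertexP ed x x ≡ + 3 * n ed x - + 2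
vertexP-own ed x with x Fin.≟ x
... | yes _ = refl
... | no x≢x = ⊥-elim (x≢x refl)

vertexP-other : ∀ ed t x → x ≢ t → vertexP ed t x ≡ lvl (n ed x)
vertexP-other ed t x x≢t with x Fin.≟ t
... | yes x≡t = ⊥-elim (x≢t x≡t)
... | no _ = refl

edgeEndpoints : ∀ ed {c : Pt} (R : ℤ → ℤ → Set) → (∀ t → t ≢ dir ed → ∀ x → R (vertexP ed t x) (c x)) →
  ∀ x → x ≢ dir ed → R (posCentroid ed x + + 1) (c x) × R (posCentroid ed x - + 2 * + 1) (c x)
edgeEndpoints ed {c} R atVertices x x≢d =
  subst (λ v → R v (c x)) (vertexP-other ed y x (swapOthers-moves d x x≢d ∘ sym)) (atVertices y (swapOthers-≢self d x x≢d) x) ,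
  subst (λ v → R v (c x)) (vertexP-own ed x) (atVertices x x≢d x)
  where
  d = dir ed
  y = swapOthers d x

posCentroid-across : ∀ ed → posCentroid ed (dir ed) ≡ lvl (n ed (dir ed)) - + 1
posCentroid-across ed = regroup (n ed (dir ed))
  where
  regroup : ∀ a → + 3 * a ≡ (+ 3 * a + + 1) - + 1
  regroup = solve-∀

negCentroid-across : ∀ ed → negCentroid ed (dir ed) ≡ lvl (n ed (dir ed)) + + 1
negCentroid-across ed = trans (negCentroid-dir ed) (regroup (n ed (dir ed)))
  where
  regroup : ∀ a → + 3 * a + + 2 ≡ (+ 3 * a + + 1) + + 1
  regroup = solve-∀

posCentroid-sum : ∀ ed → sum3 (posCentroid ed) ≡ + 0
posCentroid-sum ed = trans (factor (n ed zero) (n ed (suc zero)) (n ed (suc (suc zero)))) (cong (+ 3 *_) (sum0 ed))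
  where
  factor : ∀ a b c → + 3 * a + + 3 * b + + 3 * c ≡ + 3 * (a + b + c)
  factor = solve-∀

negCentroid-sum : ∀ ed → sum3 (negCentroid ed) ≡ + 0
negCentroid-sum ed = trans (sum3-via-swap (negCentroid ed) d x (next≢ d))
  (trans (cong₂ _+_ (cong₂ _+_ (negCentroid-dir ed) (negCentroid-other ed x (next≢ d))) (negCentroid-other ed y (swapOthers-≢self d x (next≢ d))))
  (trans (factor (n ed d) (n ed x) (n ed y)) (cong (+ 3 *_) (trans (sym (sum3-via-swap (n ed) d x (next≢ d))) (sum0 ed)))))
  where
  d = dir ed
  x = next d
  y = swapOthers d x
  factor : ∀ a b c → + 3 * a + + 2 + (+ 3 * b - + 1) + (+ 3 * c - + 1) ≡ + 3 * (a + b + c)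
  factor = solve-∀

posCentroid-offGrid : ∀ ed x m → posCentroid ed x ≢ lvl m
posCentroid-offGrid ed x m eq = lvl≢3* m (n ed x) (sym eq)

negCentroid-offGrid : ∀ ed x m → negCentroid ed x ≢ lvl m
negCentroid-offGrid ed x m eq with x Fin.≟ dir ed
... | yes _ = lvl≢3*+2 m (n ed x) (sym eq)
... | no _ = lvl≢3*+2 m (n ed x - + 1) (trans (sym eq) (regroup (n ed x)))
  where
  regroup : ∀ a → + 3 * a - + 1 ≡ + 3 * (a - + 1) + + 2
  regroup = solve-∀

inside-suc⇒lower : ∀ j (v : Pt) x → InsideCentroid (suc j) v → + 0 < + 2 * (negTwoPow j * negTwoPow j) + v x * negTwoPow j
inside-suc⇒lower j v x inside = *-cancelˡ-pos 2 (subst (+ 0 <_) (expand (negTwoPow j) (v x)) (i<j⇒0<j-i (inside x)))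
  where
  expand : ∀ t P → (- + 2 * t) * (- + 2 * t) - P * (- + 2 * t) ≡ + 2 * (+ 2 * (t * t) + P * t)
  expand = solve-∀

inside⇒lower : ∀ j v d → InsideCentroid j v → sum3 v ≡ + 0 → + 0 < + 2 * (negTwoPow j * negTwoPow j) + v d * negTwoPow j
inside⇒lower j v d inside Σ≡0 =
  subst (+ 0 <_) (trans (cong (λ u → (t * t - v x * t) + (t * t - u * t)) (sum3≡0⇒swapOthers v d x (next≢ d) Σ≡0)) (combine t (v d) (v x)))
    (ℤP.+-mono-< (i<j⇒0<j-i (inside x)) (i<j⇒0<j-i (inside (swapOthers d x))))
  where
  t = negTwoPow j
  x = next d
  combine : ∀ t a b → (t * t - b * t) + (t * t - (- a - b) * t) ≡ + 2 * (t * t) + a * t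
  combine = solve-∀

-- Inside (-2)^j T₀ every coordinate satisfies -2t² < u t < t² (t = (-2)^j); a line
-- u_d = (3W+1)t would need -2 < 3W+1 < 1.
edge-off-scaledLevel : ∀ j {p q : Pt} d L W → InsideCentroid j p → InsideCentroid j q → sum3 p ≡ + 0 → sum3 q ≡ + 0 →
  p d ≡ L - + 1 → q d ≡ L + + 1 → L ≡ (+ 3 * W + + 1) * negTwoPow j → ⊥
edge-off-scaledLevel j {p} {q} d L W p-in q-in p-sum q-sum pd≡ qd≡ L≡ =
  ℤP.<-irrefl refl (subst (+ 0 <_) (cancel W)
    (ℤP.+-mono-≤-< (ℤP.i≤j⇒0≤j-i (ℤP.i<j⇒suc[i]≤j W<0)) (*-cancelˡ-pos 6 {W + + 1} 0<6W+6)))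
  where
  t = negTwoPow j
  0<t² = 0<s*s (negTwoPow-sign j)
  pd≡′ = trans pd≡ (cong (_- + 1) L≡)
  qd≡′ = trans qd≡ (cong (_+ + 1) L≡)
  0<-6W : + 0 < (- + 6 * W) * (t * t)
  0<-6W = subst (+ 0 <_) (trans (cong₂ (λ a b → (t * t - a * t) + (t * t - b * t)) pd≡′ qd≡′) (upper t W)) (ℤP.+-mono-< (i<j⇒0<j-i (p-in d)) (i<j⇒0<j-i (q-in d)))
    where
    upper : ∀ t W → (t * t - ((+ 3 * W + + 1) * t - + 1) * t) + (t * t - ((+ 3 * W + + 1) * t + + 1) * t) ≡ (- + 6 * W) * (t * t)
    upper = solve-∀
  W<0 : W < + 0
  W<0 = ℤP.neg-cancel-< {+ 0} {W} (*-cancelˡ-pos 6 (subst (+ 0 <_) (regroup W) (*-cancelʳ-pos 0<t² 0<-6W)))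
    where
    regroup : ∀ W → - + 6 * W ≡ + 6 * (- W)
    regroup = solve-∀
  0<6W+6 : + 0 < + 6 * (W + + 1)
  0<6W+6 = *-cancelʳ-pos 0<t² (subst (+ 0 <_) (trans (cong₂ (λ a b → (+ 2 * (t * t) + a * t) + (+ 2 * (t * t) + b * t)) pd≡′ qd≡′) (lower t W)) (ℤP.+-mono-< (inside⇒lower j p d p-in p-sum) (inside⇒lower j q d q-in q-sum)))
    where
    lower : ∀ t W → (+ 2 * (t * t) + ((+ 3 * W + + 1) * t - + 1) * t) + (+ 2 * (t * t) + ((+ 3 * W + + 1) * t + + 1) * t) ≡ + 6 * (W + + 1) * (t * t)
    lower = solve-∀
  cancel : ∀ W → (+ 0 - (+ 1 + W)) + (W + + 1) ≡ + 0
  cancel = solve-∀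

-- Beyond (negTwoPow j) (p i): the centroid p lies beyond the midsegment u_i = (-2)^j
-- of (-2)^(j+1) T₀, so the folding performed by crease a (suc j) moves it.
Beyond : ℤ → ℤ → Set
Beyond t x = t * t < x * t

outside : ℕ → ℤ → Bool
outside j x = does (negTwoPow j * negTwoPow j <? x * negTwoPow j)

module _ (j : ℕ) (x : ℤ) where
  private t = negTwoPow j

  outside⇒Beyond : outside j x ≡ true → Beyond t x
  outside⇒Beyond _ with t * t <? x * t
  ... | yes beyond = beyond

  ¬outside⇒¬Beyond : outside j x ≡ false → ¬ Beyond t x
  ¬outside⇒¬Beyond _ with t * t <? x * t
  ... | no ¬beyond = ¬beyond

  Beyond⇒outside : Beyond t x → outside j x ≡ true
  Beyond⇒outside = dec-true (t * t <? x * t)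

  ¬Beyond⇒¬outside : ¬ Beyond t x → outside j x ≡ false
  ¬Beyond⇒¬outside = dec-false (t * t <? x * t)

Beyond⇒< : ∀ {t x} → + 0 < t → Beyond t x → t < x
Beyond⇒< {t} {x} 0<t = ℤP.*-cancelʳ-<-nonNeg {t} {x} t {{ℤ.nonNegative (ℤP.<⇒≤ 0<t)}}

<⇒Beyond : ∀ {t x} → + 0 < t → t < x → Beyond t x
<⇒Beyond {t} 0<t = ℤP.*-monoʳ-<-pos t {{ℤ.positive 0<t}}

Beyond⇒> : ∀ {t x} → t < + 0 → Beyond t x → x < t
Beyond⇒> {t} {x} t<0 = ℤP.*-cancelʳ-<-nonPos {t} {x} t {{ℤ.nonPositive (ℤP.<⇒≤ t<0)}}

>⇒Beyond : ∀ {t x} → t < + 0 → x < t → Beyond t x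
>⇒Beyond {t} t<0 = ℤP.*-monoʳ-<-neg t {{ℤ.negative t<0}}

Beyond-suc : ∀ {t x} → Sign t → x + + 1 ≢ t → Beyond t x → Beyond t (x + + 1)
Beyond-suc {t} {x} (inj₁ 0<t) _ beyond = <⇒Beyond {t} {x + + 1} 0<t (ℤP.<-trans (Beyond⇒< {t} {x} 0<t beyond) (≤⇒<+1 ℤP.≤-refl))
Beyond-suc {t} {x} (inj₂ t<0) x+1≢t beyond = >⇒Beyond {t} {x + + 1} t<0 (ℤP.≤∧≢⇒< (<⇒+1≤ (Beyond⇒> {t} {x} t<0 beyond)) x+1≢t)

Beyond-pred : ∀ {t x} → Sign t → x ≢ t → Beyond t (x + + 1) → Beyond t x
Beyond-pred {t} {x} (inj₁ 0<t) x≢t beyond = <⇒Beyond {t} {x} 0<t (ℤP.≤∧≢⇒< (<+1⇒≤ (Beyond⇒< {t} {x + + 1} 0<t beyond)) (x≢t ∘ sym))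
Beyond-pred {t} {x} (inj₂ t<0) _ beyond = >⇒Beyond {t} {x} t<0 (ℤP.<-trans (≤⇒<+1 ℤP.≤-refl) (Beyond⇒> {t} {x + + 1} t<0 beyond))

outside-suc : ∀ j x → x ≢ negTwoPow j → x + + 1 ≢ negTwoPow j → outside j x ≡ outside j (x + + 1)
outside-suc j x x≢t x+1≢t with outside j x in eq | outside j (x + + 1) in eq+1
... | true | true = refl
... | false | false = refl
... | true | false = ⊥-elim (¬outside⇒¬Beyond j (x + + 1) eq+1 (Beyond-suc {negTwoPow j} {x} (negTwoPow-sign j) x+1≢t (outside⇒Beyond j x eq)))
... | false | true = ⊥-elim (¬outside⇒¬Beyond j x eq (Beyond-pred {negTwoPow j} {x} (negTwoPow-sign j) x≢t (outside⇒Beyond j (x + + 1) eq+1)))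

outside-across : ∀ j L → L - + 1 ≢ negTwoPow j → L ≢ negTwoPow j → L + + 1 ≢ negTwoPow j → outside j (L - + 1) ≡ outside j (L + + 1)
outside-across j L L-1≢t L≢t L+1≢t =
  trans (outside-suc j (L - + 1) L-1≢t (L≢t ∘ trans (sym (cancel L)))) (trans (cong (outside j) (cancel L)) (outside-suc j L L≢t L+1≢t))
  where
  cancel : ∀ L → L - + 1 + + 1 ≡ L
  cancel = solve-∀

outside-≡-across : ∀ j {L σ a b} → σ ≡ + 1 ⊎ σ ≡ - + 1 → a ≡ L - σ → b ≡ L + σ →
  a ≢ negTwoPow j → L ≢ negTwoPow j → b ≢ negTwoPow j → outside j a ≡ outside j b
outside-≡-across j {L} (inj₁ refl) refl refl a≢t L≢t b≢t = outside-across j L a≢t L≢t b≢t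
outside-≡-across j {L} (inj₂ refl) refl refl a≢t L≢t b≢t = sym (outside-across j L b≢t L≢t a≢t)

outside-≡-beside : ∀ j {σ a b} → σ ≡ + 1 ⊎ σ ≡ - + 1 → b ≡ a - σ → a ≢ negTwoPow j → b ≢ negTwoPow j → outside j a ≡ outside j b
outside-≡-beside j {a = a} (inj₁ refl) refl a≢t b≢t =
  sym (trans (outside-suc j (a - + 1) b≢t (a≢t ∘ trans (sym (cancel a)))) (cong (outside j) (cancel a)))
  where
  cancel : ∀ a → a - + 1 + + 1 ≡ a
  cancel = solve-∀
outside-≡-beside j {a = a} (inj₂ refl) refl a≢t b≢t = outside-suc j a a≢t b≢t

firstOutside : Bool → Bool → Bool → Maybe (Fin 3)
firstOutside true _ _ = just zero
firstOutside false true _ = just (suc zero)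
firstOutside false false true = just (suc (suc zero))
firstOutside false false false = nothing

piece≡firstOutside : ∀ j p → piece j p ≡ firstOutside (outside j (p zero)) (outside j (p (suc zero))) (outside j (p (suc (suc zero))))
piece≡firstOutside j p with outside j (p zero) | outside j (p (suc zero)) | outside j (p (suc (suc zero)))
... | true | _ | _ = refl
... | false | true | _ = refl
... | false | false | true = refl
... | false | false | false = refl

piece≡just⇒outside : ∀ j p i → piece j p ≡ just i → outside j (p i) ≡ true
piece≡just⇒outside j p i eq rewrite piece≡firstOutside j p
  with outside j (p zero) in e₀ | outside j (p (suc zero)) in e₁ | outside j (p (suc (suc zero))) in e₂ | eq
... | true | _ | _ | refl = e₀
... | false | true | _ | refl = e₁
... | false | false | true | refl = e₂

piece≡nothing⇒¬outside : ∀ j p x → piece j p ≡ nothing → outside j (p x) ≡ false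
piece≡nothing⇒¬outside j p x eq rewrite piece≡firstOutside j p
  with outside j (p zero) in e₀ | outside j (p (suc zero)) in e₁ | outside j (p (suc (suc zero))) in e₂ | eq
... | false | false | false | refl with x
...   | zero = e₀
...   | suc zero = e₁
...   | suc (suc zero) = e₂

onlyOutside⇒piece : ∀ j p d → outside j (p d) ≡ true → (∀ x → x ≢ d → outside j (p x) ≡ false) → piece j p ≡ just d
onlyOutside⇒piece j p zero out _ rewrite piece≡firstOutside j p | out = refl
onlyOutside⇒piece j p (suc zero) out in′ rewrite piece≡firstOutside j p | out | in′ zero (λ ()) = refl
onlyOutside⇒piece j p (suc (suc zero)) out in′ rewrite piece≡firstOutside j p | out | in′ zero (λ ()) | in′ (suc zero) (λ ()) = refl

piece-cong : ∀ j p q → (∀ x → outside j (p x) ≡ outside j (q x)) → piece j p ≡ piece j q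
piece-cong j p q same rewrite piece≡firstOutside j p | piece≡firstOutside j q
  | same zero | same (suc zero) | same (suc (suc zero)) = refl

central⇒inside : ∀ j v → (∀ x m → v x ≢ lvl m) → piece j v ≡ nothing → InsideCentroid j v
central⇒inside j v offGrid central x =
  ℤP.≤∧≢⇒< (ℤP.≮⇒≥ (¬outside⇒¬Beyond j (v x) (piece≡nothing⇒¬outside j v x central))) onMidsegment
  where
  instance _ = ℤ.≢-nonZero (negTwoPow≢0 j)
  onMidsegment : v x * negTwoPow j ≢ negTwoPow j * negTwoPow j
  onMidsegment eq = offGrid x (proj₁ (negTwoPow-level j))
    (trans (ℤP.*-cancelʳ-≡ (v x) (negTwoPow j) (negTwoPow j) eq) (proj₂ (negTwoPow-level j)))

Separated : Maybe (Fin 3) → Maybe (Fin 3) → Set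
Separated nothing nothing = ⊥
Separated (just i) (just i′) = i ≢ i′
Separated _ _ = ⊤

Separated-sym : ∀ {m n} → Separated m n → Separated n m
Separated-sym {nothing} {just _} _ = tt
Separated-sym {just _} {nothing} _ = tt
Separated-sym {just _} {just _} i≢i′ = i≢i′ ∘ sym

crease-separated : ∀ a j p q π → Separated (piece j p) (piece j q) → crease a (suc j) p q π ≡ just (foldColour (a (suc j)) π)
crease-separated a j p q π sep with piece j p | piece j q
... | nothing | just _ = refl
... | just _ | nothing = refl
... | just i | just i′ with i Fin.≟ i′
...   | yes i≡i′ = ⊥-elim (sep i≡i′)
...   | no _ = refl

crease-central : ∀ a j p q π → piece j p ≡ nothing → piece j q ≡ nothing → crease a (suc j) p q π ≡ crease a j p q π
crease-central a j p q π p-central q-central rewrite p-central | q-central = refl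

crease-sameCorner : ∀ a j p q π i → piece j p ≡ just i → piece j q ≡ just i →
  crease a (suc j) p q π ≡ crease a j (reflect i (negTwoPow j) p) (reflect i (negTwoPow j) q) (not π)
crease-sameCorner a j p q π i p-corner q-corner rewrite p-corner | q-corner with i Fin.≟ i
... | yes _ = refl
... | no i≢i = ⊥-elim (i≢i refl)

not-xor-not : ∀ ω π → not ω xor not π ≡ ω xor π
not-xor-not ω π = trans (sym (Boolₚ.not-distribˡ-xor ω (not π)))
  (trans (cong not (sym (Boolₚ.not-distribʳ-xor ω π))) (Boolₚ.not-involutive (ω xor π)))

σ-unit-neg : ∀ {σ} → σ ≡ + 1 ⊎ σ ≡ - + 1 → - σ ≡ + 1 ⊎ - σ ≡ - + 1
σ-unit-neg (inj₁ σ≡1) = inj₂ (cong -_ σ≡1)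
σ-unit-neg (inj₂ σ≡-1) = inj₁ (cong -_ σ≡-1)

mirror-inside : ∀ j i v → outside j (v i) ≡ true → InsideCentroid (suc j) v → InsideCentroid j (mirror i (negTwoPow j) v)
mirror-inside j i v v-outside v-inside x with mirrorShift-cases i (negTwoPow j) x
... | inj₁ (shift≡2t , swap≡i) rewrite shift≡2t | swap≡i =
  <-by-gap _ (i<j⇒0<j-i (outside⇒Beyond j (v i) v-outside)) (gap (negTwoPow j) (v i))
  where
  gap : ∀ t P → t * t ≡ (+ 2 * t - P) * t + (P * t - t * t)
  gap = solve-∀
... | inj₂ shift≡-t rewrite shift≡-t =
  <-by-gap _ (inside-suc⇒lower j v (swapOthers i x) v-inside) (gap (negTwoPow j) (v (swapOthers i x)))
  where
  gap : ∀ t P → t * t ≡ (- t - P) * t + (+ 2 * (t * t) + P * t)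
  gap = solve-∀

mirrorShift-level : ∀ i {t m₀} → t ≡ lvl m₀ → ∀ x → ∃ λ w → mirrorShift i t x ≡ + 3 * w + + 2
mirrorShift-level i {t} {m₀} t≡lvl x with mirrorShift-cases i t x
... | inj₁ (shift≡2t , _) = + 2 * m₀ , trans shift≡2t (trans (cong (+ 2 *_) t≡lvl) (double m₀))
  where
  double : ∀ m → + 2 * (+ 3 * m + + 1) ≡ + 3 * (+ 2 * m) + + 2
  double = solve-∀
... | inj₂ shift≡-t = - m₀ - + 1 , trans shift≡-t (trans (cong -_ t≡lvl) (negate m₀))
  where
  negate : ∀ m → - (+ 3 * m + + 1) ≡ + 3 * (- m - + 1) + + 2
  negate = solve-∀

mirror-offGrid : ∀ i {t} → (∃ λ m₀ → t ≡ lvl m₀) → ∀ v → (∀ x m → v x ≢ lvl m) → ∀ x m → mirror i t v x ≢ lvl m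
mirror-offGrid i {t} (m₀ , t≡lvl) v offGrid x m on-grid with mirrorShift-level i {t} {m₀} t≡lvl x
... | w , shift≡3w+2 = offGrid (swapOthers i x) (w - m)
  (trans (isolate (mirrorShift i t x) (v (swapOthers i x))) (trans (cong₂ _-_ shift≡3w+2 on-grid) (difference w m)))
  where
  isolate : ∀ K P → P ≡ K - (K - P)
  isolate = solve-∀
  difference : ∀ w m → (+ 3 * w + + 2) - (+ 3 * m + + 1) ≡ + 3 * (w - m) + + 1
  difference = solve-∀

mirror-onLayer : ∀ i {t s} → (∃ λ w₀ → t ≡ (+ 6 * w₀ + + 4) * s) → ∀ c → (∀ x → OnLayer s (c x)) → ∀ x → OnLayer s (mirror i t c x)
mirror-onLayer i {t} {s} (w₀ , t≡) c c-onLayer x with mirrorShift-cases i t x | c-onLayer (swapOthers i x)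
... | inj₁ (shift≡2t , _) | z , c≡ = + 2 * w₀ + + 1 - z , trans (cong₂ _-_ (trans shift≡2t (cong (+ 2 *_) t≡)) c≡) (reduce w₀ z s)
  where
  reduce : ∀ w z s → + 2 * ((+ 6 * w + + 4) * s) - s * (+ 6 * z + + 1) ≡ s * (+ 6 * (+ 2 * w + + 1 - z) + + 1)
  reduce = solve-∀
... | inj₂ shift≡-t | z , c≡ = - w₀ - + 1 - z , trans (cong₂ _-_ (trans shift≡-t (cong -_ t≡)) c≡) (reduce w₀ z s)
  where
  reduce : ∀ w z s → - ((+ 6 * w + + 4) * s) - s * (+ 6 * z + + 1) ≡ s * (+ 6 * (- w - + 1 - z) + + 1)
  reduce = solve-∀

orientation : ∀ {s} → Sign s → Bool
orientation (inj₁ _) = false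
orientation (inj₂ _) = true

signOf : Bool → ℤ
signOf false = + 1
signOf true = - + 1

signOf-not : ∀ ω s → - (+ 3 * s * signOf ω) ≡ + 3 * s * signOf (not ω)
signOf-not false = negate
  where
  negate : ∀ s → - (+ 3 * s * + 1) ≡ + 3 * s * - + 1
  negate = solve-∀
signOf-not true = negate
  where
  negate : ∀ s → - (+ 3 * s * - + 1) ≡ + 3 * s * + 1
  negate = solve-∀

-- The sum of the c_t is 3 × the side length. Parallel layer lines are 6|s| apart,
-- so unless the sum is 3|s| the line at distance 6|s| from u₀ = c₀ crosses the triangle.
layerTriangle-sum : ∀ {s c₀ Σ} z₀ Z (sg : Sign s) → c₀ ≡ s * (+ 6 * z₀ + + 1) → Σ ≡ s * (+ 6 * Z + + 3) → + 0 < Σ →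
  (∀ z → ¬ ((c₀ - Σ < s * (+ 6 * z + + 1)) × (s * (+ 6 * z + + 1) < c₀))) → Σ ≡ + 3 * s * signOf (orientation sg)
layerTriangle-sum {s} z₀ Z (inj₁ 0<s) refl refl 0<Σ noLine with ℤP.<-cmp Z (+ 0)
... | tri< Z<0 _ _ = ⊥-elim (ℤP.<-irrefl refl (subst (+ 0 <_) (cancel s Z)
        (ℤP.+-mono-< 0<Σ (*-pos-pos 0<s (0<6i+3 (<0⇒0≤-i-1 Z<0))))))
  where
  cancel : ∀ s Z → s * (+ 6 * Z + + 3) + s * (+ 6 * (- Z - + 1) + + 3) ≡ + 0
  cancel = solve-∀
... | tri≈ _ refl _ = times-one s
  where
  times-one : ∀ s → s * (+ 6 * + 0 + + 3) ≡ + 3 * s * + 1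
  times-one = solve-∀
... | tri> _ _ 0<Z = ⊥-elim (noLine (z₀ - + 1)
        ( <-by-gap _ (*-pos-pos 0<s (0<6i+3 (0<⇒0≤-1 0<Z))) (gap₁ s z₀ Z)
        , <-by-gap _ (*-pos-pos {+ 6} (+<+ (ℕ.s≤s ℕ.z≤n)) 0<s) (gap₂ s z₀)))
  where
  gap₁ : ∀ s z₀ Z → s * (+ 6 * (z₀ - + 1) + + 1) ≡ (s * (+ 6 * z₀ + + 1) - s * (+ 6 * Z + + 3)) + s * (+ 6 * (Z - + 1) + + 3)
  gap₁ = solve-∀
  gap₂ : ∀ s z₀ → s * (+ 6 * z₀ + + 1) ≡ s * (+ 6 * (z₀ - + 1) + + 1) + + 6 * s
  gap₂ = solve-∀
layerTriangle-sum {s} z₀ Z (inj₂ s<0) refl refl 0<Σ noLine with ℤP.<-cmp Z (- + 1)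
... | tri< Z<-1 _ _ = ⊥-elim (noLine (z₀ + + 1)
        ( <-by-gap _ (*-pos-pos 0<-s (0<6i+3 (<0⇒0≤-i-1 (ℤP.+-monoˡ-< (+ 1) Z<-1)))) (gap₁ s z₀ Z)
        , <-by-gap _ (*-pos-pos {+ 6} (+<+ (ℕ.s≤s ℕ.z≤n)) 0<-s) (gap₂ s z₀)))
  where
  0<-s = ℤP.neg-mono-< s<0
  gap₁ : ∀ s z₀ Z → s * (+ 6 * (z₀ + + 1) + + 1) ≡ (s * (+ 6 * z₀ + + 1) - s * (+ 6 * Z + + 3)) + (- s) * (+ 6 * (- (Z + + 1) - + 1) + + 3)
  gap₁ = solve-∀
  gap₂ : ∀ s z₀ → s * (+ 6 * z₀ + + 1) ≡ s * (+ 6 * (z₀ + + 1) + + 1) + + 6 * (- s)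
  gap₂ = solve-∀
... | tri≈ _ refl _ = times-minus-one s
  where
  times-minus-one : ∀ s → s * (+ 6 * - + 1 + + 3) ≡ + 3 * s * - + 1
  times-minus-one = solve-∀
... | tri> _ _ -1<Z = ⊥-elim (ℤP.<-irrefl refl (subst (+ 0 <_) (cancel s Z)
        (ℤP.+-mono-< 0<Σ (*-pos-pos (ℤP.neg-mono-< s<0) (0<6i+3 (ℤP.i<j⇒suc[i]≤j -1<Z))))))
  where
  cancel : ∀ s Z → s * (+ 6 * Z + + 3) + (- s) * (+ 6 * Z + + 3) ≡ + 0
  cancel = solve-∀

module Layer (e : ℕ) where

  s : ℤ
  s = negTwoPow e

  even-multiple⇒2^suc∣ : ∀ {x} w → x ≡ (+ 2 * w) * s → + (2 ℕ.^ suc e) Unsigned.∣ x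
  even-multiple⇒2^suc∣ w x≡ = negTwoPow∣⇒2^∣ (suc e) (divides (- w) (trans x≡ (regroup w s)))
    where
    regroup : ∀ w s → (+ 2 * w) * s ≡ (- w) * (- + 2 * s)
    regroup = solve-∀

  layerLine⇒ : ∀ m → Λ (suc e) m → OnLayer s (lvl m)
  layerLine⇒ m (2^e∣ , 2^suc∤) with 2^∣⇒negTwoPow∣ e 2^e∣ | negTwoPow-level e
  ... | divides y lvl≡ | ms , s≡ with y %ℕ 6 | n%ℕd<d y 6 | a≡a%ℕn+[a/ℕn]*n y 6
  ...   | 0 | _ | y≡ = ⊥-elim (2^suc∤ (even-multiple⇒2^suc∣ (+ 3 * q) (trans lvl≡ (cong (_* s) (trans y≡ (regroup q))))))
    where
    q = y /ℕ 6
    regroup : ∀ q → + 0 + q * + 6 ≡ + 2 * (+ 3 * q)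
    regroup = solve-∀
  ...   | 1 | _ | y≡ = y /ℕ 6 , trans lvl≡ (trans (cong (_* s) y≡) (regroup (y /ℕ 6) s))
    where
    regroup : ∀ q s → (+ 1 + q * + 6) * s ≡ s * (+ 6 * q + + 1)
    regroup = solve-∀
  ...   | 2 | _ | y≡ = ⊥-elim (2^suc∤ (even-multiple⇒2^suc∣ (+ 3 * q + + 1) (trans lvl≡ (cong (_* s) (trans y≡ (regroup q))))))
    where
    q = y /ℕ 6
    regroup : ∀ q → + 2 + q * + 6 ≡ + 2 * (+ 3 * q + + 1)
    regroup = solve-∀
  ...   | 3 | _ | y≡ = ⊥-elim (lvl≢3* m ((+ 1 + + 2 * (y /ℕ 6)) * s) (trans lvl≡ (trans (cong (_* s) y≡) (regroup (y /ℕ 6) s))))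
    where
    regroup : ∀ q s → (+ 3 + q * + 6) * s ≡ + 3 * ((+ 1 + + 2 * q) * s)
    regroup = solve-∀
  ...   | 4 | _ | y≡ = ⊥-elim (2^suc∤ (even-multiple⇒2^suc∣ (+ 3 * q + + 2) (trans lvl≡ (cong (_* s) (trans y≡ (regroup q))))))
    where
    q = y /ℕ 6
    regroup : ∀ q → + 4 + q * + 6 ≡ + 2 * (+ 3 * q + + 2)
    regroup = solve-∀
  ...   | 5 | _ | y≡ = ⊥-elim (lvl≢3*+2 m (+ 5 * ms + + 6 * (y /ℕ 6) * ms + + 2 * (y /ℕ 6) + + 1) (trans lvl≡ (trans (cong₂ _*_ y≡ s≡) (regroup (y /ℕ 6) ms))))
    where
    regroup : ∀ q ms → (+ 5 + q * + 6) * (+ 3 * ms + + 1) ≡ + 3 * (+ 5 * ms + + 6 * q * ms + + 2 * q + + 1) + + 2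
    regroup = solve-∀
  ...   | suc (suc (suc (suc (suc (suc _))))) | ℕ.s≤s (ℕ.s≤s (ℕ.s≤s (ℕ.s≤s (ℕ.s≤s (ℕ.s≤s ()))))) | _

  layerLine⇐ : ∀ z → ∃ λ m → lvl m ≡ s * (+ 6 * z + + 1) × Λ (suc e) m
  layerLine⇐ z with negTwoPow-level e
  ... | ms , s≡ = m , lvl≡ , negTwoPow∣⇒2^∣ e (divides (+ 6 * z + + 1) (trans lvl≡ (ℤP.*-comm s _))) , 2^suc∤
    where
    instance _ = ℤ.≢-nonZero (negTwoPow≢0 e)
    m = + 6 * ms * z + ms + + 2 * z
    lvl≡ : lvl m ≡ s * (+ 6 * z + + 1)
    lvl≡ = trans (factor ms z) (cong (_* (+ 6 * z + + 1)) (sym s≡))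
      where
      factor : ∀ ms z → + 3 * (+ 6 * ms * z + ms + + 2 * z) + + 1 ≡ (+ 3 * ms + + 1) * (+ 6 * z + + 1)
      factor = solve-∀
    2^suc∤ : ¬ (+ (2 ℕ.^ suc e) Unsigned.∣ lvl m)
    2^suc∤ 2^suc∣ with 2^∣⇒negTwoPow∣ (suc e) 2^suc∣
    ... | divides w lvl≡w = n*a≢r 2 1 (- w - + 3 * z) (ℕ.s≤s ℕ.z≤n) (ℕ.s≤s (ℕ.s≤s ℕ.z≤n))
      (trans (expand w z) (trans (cong (λ u → - + 2 * w - u + + 1) odd≡even) (cancel (- + 2 * w))))
      where
      odd≡even : + 6 * z + + 1 ≡ - + 2 * w
      odd≡even = ℤP.*-cancelˡ-≡ s _ _ (trans (sym lvl≡) (trans lvl≡w (regroup w s)))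
        where
        regroup : ∀ w s → w * (- + 2 * s) ≡ s * (- + 2 * w)
        regroup = solve-∀
      expand : ∀ w z → + 2 * (- w - + 3 * z) ≡ - + 2 * w - (+ 6 * z + + 1) + + 1
      expand = solve-∀
      cancel : ∀ x → x - x + + 1 ≡ + 1
      cancel = solve-∀

  Within : Bool → ℤ → ℤ → Set
  Within false v w = v * s ℤ.≤ w * s
  Within true v w = w * s ℤ.≤ v * s

  Within-mirror : ∀ ω K {v w v′} → v′ ≡ K - v → Within ω v w → Within (not ω) v′ (K - w)
  Within-mirror false K {v} {w} refl v≤w = ≤-by-gap _ (ℤP.i≤j⇒0≤j-i v≤w) (gap K v w s)
    where
    gap : ∀ K v w s → (K - v) * s ≡ (K - w) * s + (w * s - v * s)
    gap = solve-∀
  Within-mirror true K {v} {w} refl w≤v = ≤-by-gap _ (ℤP.i≤j⇒0≤j-i w≤v) (gap K v w s)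
    where
    gap : ∀ K v w s → (K - w) * s ≡ (K - v) * s + (v * s - w * s)
    gap = solve-∀

  -- p and q are the current positions of the two unit triangles adjacent along
  -- the edge, which lies on the line u_d = L and has endpoints with coordinates
  -- p x + σ and p x - 2σ off d; c is the current position of the layer triangle
  -- {u : Within ω (u x) (c x) for all x} whose boundary contains the edge.
  record FoldState (j : ℕ) (p q : Pt) (d : Fin 3) (L σ : ℤ) (c : Pt) (ω : Bool) : Set where
    field
      p-inside : InsideCentroid (suc j) p
      q-inside : InsideCentroid (suc j) q
      p-d : p d ≡ L - σ
      q-d : q d ≡ L + σ
      q-other : ∀ x → x ≢ d → q x ≡ p x - σ
      σ-unit : σ ≡ + 1 ⊎ σ ≡ - + 1
      p-offGrid : ∀ x m → p x ≢ lvl m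
      q-offGrid : ∀ x m → q x ≢ lvl m
      p-sum : sum3 p ≡ + 0
      q-sum : sum3 q ≡ + 0
      c-onLayer : ∀ x → OnLayer s (c x)
      c-d : c d ≡ L
      c-sum : sum3 c ≡ + 3 * s * signOf ω
      edge-within : ∀ x → x ≢ d → Within ω (p x + σ) (c x) × Within ω (p x - + 2 * σ) (c x)
  open FoldState

  FoldState-resp : ∀ {j p q p′ q′ d L σ c ω} → (∀ x → p x ≡ p′ x) → (∀ x → q x ≡ q′ x) →
    FoldState j p q d L σ c ω → FoldState j p′ q′ d L σ c ω
  FoldState-resp {j} {σ = σ} {c} {ω} p≗ q≗ st = record
    { p-inside = λ x → subst (λ u → u * t < t * t) (p≗ x) (p-inside st x)
    ; q-inside = λ x → subst (λ u → u * t < t * t) (q≗ x) (q-inside st x)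
    ; p-d = trans (sym (p≗ _)) (p-d st)
    ; q-d = trans (sym (q≗ _)) (q-d st)
    ; q-other = λ x x≢d → trans (sym (q≗ x)) (trans (q-other st x x≢d) (cong (_- σ) (p≗ x)))
    ; σ-unit = σ-unit st
    ; p-offGrid = λ x m eq → p-offGrid st x m (trans (p≗ x) eq)
    ; q-offGrid = λ x m eq → q-offGrid st x m (trans (q≗ x) eq)
    ; p-sum = trans (sym (sum3-cong p≗)) (p-sum st)
    ; q-sum = trans (sym (sum3-cong q≗)) (q-sum st)
    ; c-onLayer = c-onLayer st
    ; c-d = c-d st
    ; c-sum = c-sum st
    ; edge-within = λ x x≢d → subst (λ u → Within ω (u + σ) (c x) × Within ω (u - + 2 * σ) (c x)) (p≗ x) (edge-within st x x≢d)
    }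
    where t = negTwoPow (suc j)

  FoldState-central : ∀ {j p q d L σ c ω} → piece (suc j) p ≡ nothing → piece (suc j) q ≡ nothing →
    FoldState (suc j) p q d L σ c ω → FoldState j p q d L σ c ω
  FoldState-central {j} {p} {q} p-central q-central st = record
    { p-inside = central⇒inside (suc j) p (p-offGrid st) p-central
    ; q-inside = central⇒inside (suc j) q (q-offGrid st) q-central
    ; p-d = p-d st ; q-d = q-d st ; q-other = q-other st ; σ-unit = σ-unit st
    ; p-offGrid = p-offGrid st ; q-offGrid = q-offGrid st ; p-sum = p-sum st ; q-sum = q-sum st
    ; c-onLayer = c-onLayer st ; c-d = c-d st ; c-sum = c-sum st ; edge-within = edge-within st
    }

  foldLine-scale : ∀ r → ∃ λ w → negTwoPow (suc r ℕ.+ e) ≡ (+ 6 * w + + 4) * s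
  foldLine-scale r with negTwoPow-suc≡6w+4 r
  ... | w , t≡ = w , trans (negTwoPow-+ (suc r) e) (cong (_* s) t≡)

  FoldState-mirror : ∀ r {p q d L σ c ω} i → let t = negTwoPow (suc r ℕ.+ e) in
    FoldState (suc r ℕ.+ e) p q d L σ c ω → outside (suc r ℕ.+ e) (p i) ≡ true → outside (suc r ℕ.+ e) (q i) ≡ true →
    FoldState (r ℕ.+ e) (mirror i t p) (mirror i t q) (swapOthers i d) (mirrorShift i t (swapOthers i d) - L) (- σ) (mirror i t c) (not ω)
  FoldState-mirror r {p} {q} {d} {L} {σ} {c} {ω} i st p-out q-out = record
    { p-inside = mirror-inside j i p p-out (p-inside st)
    ; q-inside = mirror-inside j i q q-out (q-inside st)
    ; p-d = trans (at-d p) (trans (cong (λ u → K d′ - u) (p-d st)) (minus-shift (K d′) L σ))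
    ; q-d = trans (at-d q) (trans (cong (λ u → K d′ - u) (q-d st)) (plus-shift (K d′) L σ))
    ; q-other = λ x x≢d′ → trans (cong (λ u → K x - u) (q-other st (swapOthers i x) (swapOthers-≢ i x d x≢d′))) (minus-shift (K x) (p (swapOthers i x)) σ)
    ; σ-unit = σ-unit-neg (σ-unit st)
    ; p-offGrid = mirror-offGrid i t-level p (p-offGrid st)
    ; q-offGrid = mirror-offGrid i t-level q (q-offGrid st)
    ; p-sum = trans (sum3-mirror i t p) (cong -_ (p-sum st))
    ; q-sum = trans (sum3-mirror i t q) (cong -_ (q-sum st))
    ; c-onLayer = mirror-onLayer i (foldLine-scale r) c (c-onLayer st)
    ; c-d = trans (at-d c) (cong (λ u → K d′ - u) (c-d st))
    ; c-sum = trans (sum3-mirror i t c) (trans (cong -_ (c-sum st)) (signOf-not ω s))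
    ; edge-within = within
    }
    where
    j = suc r ℕ.+ e
    t = negTwoPow j
    d′ = swapOthers i d
    K = mirrorShift i t
    t-level = negTwoPow-level j
    at-d : ∀ (v : Pt) → mirror i t v d′ ≡ K d′ - v d
    at-d v = cong (λ y → K d′ - v y) (swapOthers-involutive i d)
    minus-shift : ∀ K L σ → K - (L - σ) ≡ (K - L) - (- σ)
    minus-shift = solve-∀
    plus-shift : ∀ K L σ → K - (L + σ) ≡ (K - L) + (- σ)
    plus-shift = solve-∀
    endpoint₁ : ∀ K P σ → (K - P) + (- σ) ≡ K - (P + σ)
    endpoint₁ = solve-∀
    endpoint₂ : ∀ K P σ → (K - P) - + 2 * (- σ) ≡ K - (P - + 2 * σ)
    endpoint₂ = solve-∀
    within : ∀ x → x ≢ d′ → Within (not ω) (mirror i t p x + - σ) (mirror i t c x) × Within (not ω) (mirror i t p x - + 2 * (- σ)) (mirror i t c x)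
    within x x≢d′ with edge-within st (swapOthers i x) (swapOthers-≢ i x d x≢d′)
    ... | w₁ , w₂ = Within-mirror ω (K x) (endpoint₁ (K x) _ σ) w₁ , Within-mirror ω (K x) (endpoint₂ (K x) _ σ) w₂

  0<s² : + 0 < s * s
  0<s² = 0<s*s (negTwoPow-sign e)

  inside-suc⇒upper : ∀ v d → InsideCentroid (suc e) v → sum3 v ≡ + 0 → + 0 < + 4 * (s * s) - v d * s
  inside-suc⇒upper v d inside Σ≡0 =
    subst (+ 0 <_) (trans (cong (λ u → (+ 2 * (s * s) + v x * s) + (+ 2 * (s * s) + u * s)) (sum3≡0⇒swapOthers v d x (next≢ d) Σ≡0))
                          (combine s (v d) (v x)))
      (ℤP.+-mono-< (inside-suc⇒lower e v x inside) (inside-suc⇒lower e v (swapOthers d x) inside))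
    where
    x = next d
    combine : ∀ s a b → (+ 2 * (s * s) + b * s) + (+ 2 * (s * s) + (- a - b) * s) ≡ + 4 * (s * s) - a * s
    combine = solve-∀

  line≡s : ∀ {p q d L σ c ω} → FoldState e p q d L σ c ω → L ≡ s
  line≡s {p} {q} {d} {L} {σ} st with c-onLayer st d
  ... | z , cd≡ = trans L≡ (trans (cong (λ z → s * (+ 6 * z + + 1)) z≡0) (*-one s))
    where
    L≡ : L ≡ s * (+ 6 * z + + 1)
    L≡ = trans (sym (c-d st)) cd≡
    lowerSum : ∀ {a b} → a ≡ s * (+ 6 * z + + 1) - σ → b ≡ s * (+ 6 * z + + 1) + σ →
      (+ 2 * (s * s) + a * s) + (+ 2 * (s * s) + b * s) ≡ (+ 6 * z + + 3) * (+ 2 * (s * s))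
    lowerSum refl refl = identity s z σ
      where
      identity : ∀ s z σ → (+ 2 * (s * s) + (s * (+ 6 * z + + 1) - σ) * s) + (+ 2 * (s * s) + (s * (+ 6 * z + + 1) + σ) * s) ≡ (+ 6 * z + + 3) * (+ 2 * (s * s))
      identity = solve-∀
    upperSum : ∀ {a b} → a ≡ s * (+ 6 * z + + 1) - σ → b ≡ s * (+ 6 * z + + 1) + σ →
      (+ 4 * (s * s) - a * s) + (+ 4 * (s * s) - b * s) ≡ (+ 3 - + 6 * z) * (+ 2 * (s * s))
    upperSum refl refl = identity s z σ
      where
      identity : ∀ s z σ → (+ 4 * (s * s) - (s * (+ 6 * z + + 1) - σ) * s) + (+ 4 * (s * s) - (s * (+ 6 * z + + 1) + σ) * s) ≡ (+ 3 - + 6 * z) * (+ 2 * (s * s))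
      identity = solve-∀
    0<2s² : + 0 < + 2 * (s * s)
    0<2s² = *-pos-pos {+ 2} {s * s} (+<+ (ℕ.s≤s ℕ.z≤n)) 0<s²
    pd≡ = trans (p-d st) (cong (_- σ) L≡)
    qd≡ = trans (q-d st) (cong (_+ σ) L≡)
    z≡0 : z ≡ + 0
    z≡0 = 6z+3>0∧3-6z>0⇒z≡0 z
      (*-cancelʳ-pos 0<2s² (subst (+ 0 <_) (lowerSum pd≡ qd≡)
        (ℤP.+-mono-< (inside-suc⇒lower e p d (p-inside st)) (inside-suc⇒lower e q d (q-inside st)))))
      (*-cancelʳ-pos 0<2s² (subst (+ 0 <_) (upperSum pd≡ qd≡)
        (ℤP.+-mono-< (inside-suc⇒upper p d (p-inside st) (p-sum st)) (inside-suc⇒upper q d (q-inside st) (q-sum st)))))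
    *-one : ∀ s → s * (+ 6 * + 0 + + 1) ≡ s
    *-one = solve-∀

  below-s² : ∀ {qx qd qy} px cx σ → qx ≡ px - σ → qd ≡ s + σ → qy ≡ - qd - qx →
    + 0 < + 2 * (s * s) + qy * s → cx * s ℤ.≤ (px + σ) * s → cx * s ℤ.≤ (px - + 2 * σ) * s → cx * s < s * s
  below-s² px cx σ refl refl refl 0<P w₁ w₂ =
    <-by-gap _ (*-cancelˡ-pos 3 (subst (+ 0 <_) (identity s px cx σ)
      (ℤP.+-mono-<-≤ (ℤP.+-mono-< (ℤP.+-mono-< 0<P 0<P) 0<P)
                     (ℤP.+-mono-≤ (ℤP.+-mono-≤ (ℤP.i≤j⇒0≤j-i w₁) (ℤP.i≤j⇒0≤j-i w₁)) (ℤP.i≤j⇒0≤j-i w₂)))))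
      (gap s cx)
    where
    identity : ∀ s px cx σ →
      ((+ 2 * (s * s) + (- (s + σ) - (px - σ)) * s) + (+ 2 * (s * s) + (- (s + σ) - (px - σ)) * s) + (+ 2 * (s * s) + (- (s + σ) - (px - σ)) * s))
        + (((px + σ) * s - cx * s) + ((px + σ) * s - cx * s) + ((px - + 2 * σ) * s - cx * s))
      ≡ + 3 * (s * s - cx * s)
    identity = solve-∀
    gap : ∀ s cx → s * s ≡ cx * s + (s * s - cx * s)
    gap = solve-∀

  reversed⇒below-s² : ∀ {p q d L σ c} → FoldState e p q d L σ c true → ∀ x → x ≢ d → c x * s < s * s
  reversed⇒below-s² {p} {q} {d} {L} {σ} {c} st x x≢d =
    below-s² (p x) (c x) σ (q-other st x x≢d) (trans (q-d st) (cong (_+ σ) (line≡s st)))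
      (sum3≡0⇒swapOthers q d x x≢d (q-sum st)) (inside-suc⇒lower e q (swapOthers d x) (q-inside st))
      (proj₁ (edge-within st x x≢d)) (proj₂ (edge-within st x x≢d))

  OnLayer-below : ∀ {x} z → x ≡ s * (+ 6 * z + + 1) → x * s < s * s → z < + 0
  OnLayer-below z refl below = ℤP.neg-cancel-< {+ 0} {z}
    (*-cancelʳ-pos (*-pos-pos {+ 6} {s * s} (+<+ (ℕ.s≤s ℕ.z≤n)) 0<s²) (subst (+ 0 <_) (identity s z) (i<j⇒0<j-i below)))
    where
    identity : ∀ s z → s * s - s * (+ 6 * z + + 1) * s ≡ (- z) * (+ 6 * (s * s))
    identity = solve-∀

  notReversed : ∀ {p q d L σ c ω} → FoldState e p q d L σ c ω → ω ≡ false
  notReversed {ω = false} _ = refl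
  notReversed {p} {q} {d} {L} {σ} {c} {true} st with c-onLayer st (next d) | c-onLayer st (swapOthers d (next d))
  ... | zx , cx≡ | zy , cy≡ = ⊥-elim (ℤP.<-irrefl refl (subst (+ 0 <_) (trans (rearrange zx zy) (cong -_ six-zero)) positive))
    where
    x = next d
    y = swapOthers d x
    instance _ = ℤ.≢-nonZero (negTwoPow≢0 e)
    sum≡ : s + s * (+ 6 * zx + + 1) + s * (+ 6 * zy + + 1) ≡ + 3 * s * - + 1
    sum≡ = trans (sym (cong₂ _+_ (cong₂ _+_ (trans (c-d st) (line≡s st)) cx≡) cy≡))
             (trans (sym (sum3-via-swap c d x (next≢ d))) (c-sum st))
    factor : ∀ s zx zy → s * (+ 6 * (zx + zy + + 1)) ≡ (s + s * (+ 6 * zx + + 1) + s * (+ 6 * zy + + 1)) - + 3 * s * - + 1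
    factor = solve-∀
    six-zero : + 6 * (zx + zy + + 1) ≡ + 0
    six-zero = ℤP.*-cancelˡ-≡ s _ _ (trans (factor s zx zy)
      (trans (cong (_- + 3 * s * - + 1) sum≡) (trans (ℤP.+-inverseʳ (+ 3 * s * - + 1)) (sym (ℤP.*-zeroʳ s)))))
    positive : + 0 < + 6 * (- zx - + 1) + + 6 * (- zy - + 1) + + 6
    positive = ℤP.+-mono-≤-< (ℤP.+-mono-≤ (0≤n* 6 (<0⇒0≤-i-1 (OnLayer-below zx cx≡ (reversed⇒below-s² st x (next≢ d)))))
                                          (0≤n* 6 (<0⇒0≤-i-1 (OnLayer-below zy cy≡ (reversed⇒below-s² st y (swapOthers-≢self d x (next≢ d)))))))
                             (+<+ (ℕ.s≤s ℕ.z≤n))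
    rearrange : ∀ zx zy → + 6 * (- zx - + 1) + + 6 * (- zy - + 1) + + 6 ≡ - (+ 6 * (zx + zy + + 1))
    rearrange = solve-∀

  onlyOneBeyond : ∀ W d → InsideCentroid (suc e) W → sum3 W ≡ + 0 → Beyond s (W d) → ∀ x → x ≢ d → ¬ Beyond s (W x)
  onlyOneBeyond W d inside Σ≡0 beyond-d x x≢d beyond-x =
    ℤP.<-irrefl refl (subst (+ 0 <_) (trans (identity s (W d) (W x) (W y)) (trans (cong (_* s) (trans (sym (sum3-via-swap W d x x≢d)) Σ≡0)) (ℤP.*-zeroˡ s)))
      (ℤP.+-mono-< (ℤP.+-mono-< (i<j⇒0<j-i beyond-d) (i<j⇒0<j-i beyond-x)) (inside-suc⇒lower e W y inside)))
    where
    y = swapOthers d x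
    identity : ∀ s a b c → (a * s - s * s) + (b * s - s * s) + (+ 2 * (s * s) + c * s) ≡ (a + b + c) * s
    identity = solve-∀

  separatedIfBeyond : ∀ W V d → InsideCentroid (suc e) W → sum3 W ≡ + 0 → Beyond s (W d) → ¬ Beyond s (V d) →
    Separated (piece e W) (piece e V)
  separatedIfBeyond W V d inside Σ≡0 W-beyond V-within
    rewrite onlyOutside⇒piece e W d (Beyond⇒outside e (W d) W-beyond)
              (λ x x≢d → ¬Beyond⇒¬outside e (W x) (onlyOneBeyond W d inside Σ≡0 W-beyond x x≢d))
    with piece e V in V-piece
  ... | nothing = tt
  ... | just i = λ d≡i → V-within (outside⇒Beyond e (V d) (subst (λ k → outside e (V k) ≡ true) (sym d≡i) (piece≡just⇒outside e V i V-piece)))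

  Beyond-s+σ : ∀ σ → + 0 < σ * s → Beyond s (s + σ)
  Beyond-s+σ σ 0<σs = <-by-gap _ 0<σs (expand s σ)
    where
    expand : ∀ s σ → (s + σ) * s ≡ s * s + σ * s
    expand = solve-∀

  ¬Beyond-s-σ : ∀ σ → + 0 < σ * s → ¬ Beyond s (s - σ)
  ¬Beyond-s-σ σ 0<σs = ℤP.<-asym (<-by-gap _ 0<σs (expand s σ))
    where
    expand : ∀ s σ → s * s ≡ (s - σ) * s + σ * s
    expand = solve-∀

  σs-sign : ∀ {σ} → σ ≡ + 1 ⊎ σ ≡ - + 1 → Sign (σ * s)
  σs-sign (inj₁ refl) = subst Sign (sym (ℤP.*-identityˡ s)) (negTwoPow-sign e)
  σs-sign (inj₂ refl) with negTwoPow-sign e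
  ... | inj₁ 0<s = inj₂ (subst (_< + 0) (sym (ℤP.-1*i≡-i s)) (ℤP.neg-mono-< 0<s))
  ... | inj₂ s<0 = inj₁ (subst (+ 0 <_) (sym (ℤP.-1*i≡-i s)) (ℤP.neg-mono-< s<0))

  separatedAtLayer : ∀ {p q d L σ c ω} → FoldState e p q d L σ c ω → Separated (piece e p) (piece e q)
  separatedAtLayer {p} {q} {d} {L} {σ} st = bySign (σs-sign (σ-unit st))
    where
    pd≡ = trans (p-d st) (cong (_- σ) (line≡s st))
    qd≡ = trans (q-d st) (cong (_+ σ) (line≡s st))
    bySign : Sign (σ * s) → Separated (piece e p) (piece e q)
    bySign (inj₁ 0<σs) = Separated-sym (separatedIfBeyond q p d (q-inside st) (q-sum st)
      (subst (Beyond s) (sym qd≡) (Beyond-s+σ σ 0<σs)) (subst (¬_ ∘ Beyond s) (sym pd≡) (¬Beyond-s-σ σ 0<σs)))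
    bySign (inj₂ σs<0) = separatedIfBeyond p q d (p-inside st) (p-sum st)
      (subst (Beyond s) (sym pd≡) (Beyond-s+σ (- σ) 0<-σs))
      (subst (¬_ ∘ Beyond s) (trans (cong (λ u → s + u) (ℤP.neg-involutive σ)) (sym qd≡)) (¬Beyond-s-σ (- σ) 0<-σs))
      where
      0<-σs : + 0 < - σ * s
      0<-σs = subst (+ 0 <_) (ℤP.neg-distribˡ-* σ s) (ℤP.neg-mono-< σs<0)

  crease-atLayer : ∀ a {p q d L σ c ω} π → FoldState e p q d L σ c ω → crease a (suc e) p q π ≡ just (foldColour (a (suc e)) (ω xor π))
  crease-atLayer a {p} {q} π st rewrite notReversed st = crease-separated a e p q π (separatedAtLayer st)

  layerLine≢foldLine : ∀ r {L} → OnLayer s L → L ≢ negTwoPow (suc r ℕ.+ e)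
  layerLine≢foldLine r {L} (z , L≡) L≡t with foldLine-scale r
  ... | w , t≡ = n*a≢r 6 3 (z - w) (ℕ.s≤s ℕ.z≤n) (ℕ.s≤s (ℕ.s≤s (ℕ.s≤s (ℕ.s≤s ℕ.z≤n))))
    (trans (difference z w) (trans (cong (λ u → u - (+ 6 * w + + 4) + + 3) 6z+1≡6w+4) (cancel w)))
    where
    instance _ = ℤ.≢-nonZero (negTwoPow≢0 e)
    6z+1≡6w+4 : + 6 * z + + 1 ≡ + 6 * w + + 4
    6z+1≡6w+4 = ℤP.*-cancelˡ-≡ s _ _ (trans (sym L≡) (trans L≡t (trans t≡ (ℤP.*-comm _ s))))
    difference : ∀ z w → + 6 * (z - w) ≡ (+ 6 * z + + 1) - (+ 6 * w + + 4) + + 3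
    difference = solve-∀
    cancel : ∀ w → (+ 6 * w + + 4) - (+ 6 * w + + 4) + + 3 ≡ + 3
    cancel = solve-∀

  samePiece : ∀ r {p q d L σ c ω} → FoldState (suc r ℕ.+ e) p q d L σ c ω → piece (suc r ℕ.+ e) p ≡ piece (suc r ℕ.+ e) q
  samePiece r {p} {q} {d} {L} st = piece-cong j p q sameSide
    where
    j = suc r ℕ.+ e
    ≢t : ∀ {v} → (∀ m → v ≢ lvl m) → v ≢ negTwoPow j
    ≢t offGrid = offGrid⇒≢level offGrid (negTwoPow-level j)
    sameSide : ∀ x → outside j (p x) ≡ outside j (q x)
    sameSide x with x Fin.≟ d
    ... | yes refl = outside-≡-across j (σ-unit st) (p-d st) (q-d st) (≢t (p-offGrid st x))
                       (layerLine≢foldLine r (subst (OnLayer s) (c-d st) (c-onLayer st x))) (≢t (q-offGrid st x))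
    ... | no x≢d = outside-≡-beside j (σ-unit st) (q-other st x x≢d) (≢t (p-offGrid st x)) (≢t (q-offGrid st x))

  crease-fromState : ∀ a r {p q d L σ c ω} π → FoldState (r ℕ.+ e) p q d L σ c ω →
    crease a (suc (r ℕ.+ e)) p q π ≡ just (foldColour (a (suc e)) (ω xor π))
  crease-fromState a zero π st = crease-atLayer a π st
  crease-fromState a (suc r) {p} {q} {ω = ω} π st = byPiece (piece j q) refl
    where
    j = suc r ℕ.+ e
    t = negTwoPow j
    byPiece : ∀ m → piece j q ≡ m → crease a (suc j) p q π ≡ just (foldColour (a (suc e)) (ω xor π))
    byPiece nothing q-piece = trans (crease-central a j p q π p-piece q-piece)
      (crease-fromState a r π (FoldState-central p-piece q-piece st))
      where
      p-piece = trans (samePiece r st) q-piece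
    byPiece (just i) q-piece = trans (crease-sameCorner a j p q π i p-piece q-piece)
      (trans (crease-fromState a r (not π)
               (FoldState-resp (sym ∘ reflect≗mirror i t p (p-sum st)) (sym ∘ reflect≗mirror i t q (q-sum st))
                 (FoldState-mirror r i st (piece≡just⇒outside j p i p-piece) (piece≡just⇒outside j q i q-piece))))
             (cong (λ b → just (foldColour (a (suc e)) b)) (not-xor-not ω π)))
      where
      p-piece = trans (samePiece r st) q-piece

  interior⇒layer≤K : ∀ K ed → InteriorEdge K ed → OnLayer s (lvl (n ed (dir ed))) → suc e ≤ K
  interior⇒layer≤K K ed (P-in , N-in) (z , L≡) with suc e ℕ.≤? K
  ... | yes e<K = e<K
  ... | no e≮K with negTwoPow-level (e ℕ.∸ K)
  ...   | w₀ , s/t≡ = ⊥-elim (edge-off-scaledLevel K {posCentroid ed} {negCentroid ed} (dir ed) (lvl (n ed (dir ed))) (+ 6 * w₀ * z + w₀ + + 2 * z)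
            P-in N-in (posCentroid-sum ed) (negCentroid-sum ed) (posCentroid-across ed) (negCentroid-across ed) L≡scaled)
    where
    t = negTwoPow K
    s≡ : s ≡ (+ 3 * w₀ + + 1) * t
    s≡ = trans (cong negTwoPow (sym (ℕP.m∸n+n≡m (ℕP.≤-pred (ℕP.≰⇒> e≮K))))) (trans (negTwoPow-+ (e ℕ.∸ K) K) (cong (_* t) s/t≡))
    L≡scaled : lvl (n ed (dir ed)) ≡ (+ 3 * (+ 6 * w₀ * z + w₀ + + 2 * z) + + 1) * t
    L≡scaled = trans L≡ (trans (cong (_* (+ 6 * z + + 1)) s≡) (regroup w₀ z t))
      where
      regroup : ∀ w z t → ((+ 3 * w + + 1) * t) * (+ 6 * z + + 1) ≡ (+ 3 * (+ 6 * w * z + w + + 2 * z) + + 1) * t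
      regroup = solve-∀

  sides-onLayer : ∀ {c : Pt} → (∀ t → ∃ λ m → Λ (suc e) m × c t ≡ lvl m) → ∀ t → OnLayer s (c t)
  sides-onLayer sides t with sides t
  ... | m , Λm , ct≡ with layerLine⇒ m Λm
  ...   | z , lvl≡ = z , trans ct≡ lvl≡

  sum3-onLayer : ∀ {c : Pt} → (∀ t → OnLayer s (c t)) → ∃ λ Z → sum3 c ≡ s * (+ 6 * Z + + 3)
  sum3-onLayer on with on zero | on (suc zero) | on (suc (suc zero))
  ... | z₀ , c₀≡ | z₁ , c₁≡ | z₂ , c₂≡ = z₀ + z₁ + z₂ , trans (cong₂ _+_ (cong₂ _+_ c₀≡ c₁≡) c₂≡) (collect s z₀ z₁ z₂)
    where
    collect : ∀ s a b c → s * (+ 6 * a + + 1) + s * (+ 6 * b + + 1) + s * (+ 6 * c + + 1) ≡ s * (+ 6 * (a + b + c) + + 3)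
    collect = solve-∀

  posTriangle-sum : ∀ {c} → PosTriangle (suc e) c → (sg : Sign s) → sum3 c ≡ + 3 * s * signOf (orientation sg)
  posTriangle-sum {c} T sg = layerTriangle-sum {s} {c zero} {sum3 c} (proj₁ c₀) (proj₁ Σ) sg (proj₂ c₀) (proj₂ Σ) nondeg noLine
    where
    open PosTriangle T
    c₀ = sides-onLayer sides zero
    Σ = sum3-onLayer (sides-onLayer sides)
    noLine : ∀ z → ¬ ((c zero - sum3 c < s * (+ 6 * z + + 1)) × (s * (+ 6 * z + + 1) < c zero))
    noLine z between = crossing (layerLine⇐ z)
      where
      crossing : (∃ λ m → lvl m ≡ s * (+ 6 * z + + 1) × Λ (suc e) m) → ⊥
      crossing (m , lvl≡ , Λm) = face zero m Λm (subst (λ ℓ → (c zero - sum3 c < ℓ) × (ℓ < c zero)) (sym lvl≡) between)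

  negTriangle-sum : ∀ {c} → NegTriangle (suc e) c → (sg : Sign s) → sum3 c ≡ + 3 * s * signOf (not (orientation sg))
  negTriangle-sum {c} T sg = trans (unnegate (sum3 c) _ negated) (cong (λ ω → + 3 * s * signOf ω) (orientation-neg sg))
    where
    open NegTriangle T
    c₀ = sides-onLayer sides zero
    Σ = sum3-onLayer (sides-onLayer sides)
    -ℓ≡ : ∀ z → - (s * (+ 6 * z + + 1)) ≡ (- s) * (+ 6 * z + + 1)
    -ℓ≡ z = ℤP.neg-distribˡ-* s (+ 6 * z + + 1)
    noLine : ∀ z → ¬ ((- c zero - - sum3 c < (- s) * (+ 6 * z + + 1)) × ((- s) * (+ 6 * z + + 1) < - c zero))
    noLine z (lo , hi) = crossing (layerLine⇐ z)
      where
      negate-difference : ∀ a b → - a - - b ≡ - (a - b)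
      negate-difference = solve-∀
      crossing : (∃ λ m → lvl m ≡ s * (+ 6 * z + + 1) × Λ (suc e) m) → ⊥
      crossing (m , lvl≡ , Λm) = face zero m Λm
        ( ℤP.neg-cancel-< (subst (_< - c zero) (sym (trans (cong -_ lvl≡) (-ℓ≡ z))) hi)
        , ℤP.neg-cancel-< (subst₂ _<_ (negate-difference (c zero) (sum3 c)) (sym (trans (cong -_ lvl≡) (-ℓ≡ z))) lo) )
    negated : - sum3 c ≡ + 3 * (- s) * signOf (orientation (Sign-neg sg))
    negated = layerTriangle-sum { - s} { - c zero} { - sum3 c} (proj₁ c₀) (proj₁ Σ) (Sign-neg sg)
      (trans (cong -_ (proj₂ c₀)) (-ℓ≡ (proj₁ c₀))) (trans (cong -_ (proj₂ Σ)) (ℤP.neg-distribˡ-* s _))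
      (ℤP.neg-mono-< nondeg) noLine
    unnegate : ∀ Σ k → - Σ ≡ + 3 * (- s) * k → Σ ≡ + 3 * s * k
    unnegate Σ k -Σ≡ = trans (sym (ℤP.neg-involutive Σ)) (trans (cong -_ -Σ≡) (regroup s k))
      where
      regroup : ∀ s k → - (+ 3 * (- s) * k) ≡ + 3 * s * k
      regroup = solve-∀
    orientation-neg : ∀ (sg : Sign s) → orientation (Sign-neg sg) ≡ not (orientation sg)
    orientation-neg (inj₁ _) = refl
    orientation-neg (inj₂ _) = refl

  ≤⇒Within : ∀ (sg : Sign s) {v w} → v ℤ.≤ w → Within (orientation sg) v w
  ≤⇒Within (inj₁ 0<s) = ℤP.*-monoʳ-≤-nonNeg s {{ℤ.nonNegative (ℤP.<⇒≤ 0<s)}}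
  ≤⇒Within (inj₂ s<0) = ℤP.*-monoʳ-≤-nonPos s {{ℤ.nonPositive (ℤP.<⇒≤ s<0)}}

  ≥⇒Within : ∀ (sg : Sign s) {v w} → w ℤ.≤ v → Within (not (orientation sg)) v w
  ≥⇒Within (inj₁ 0<s) = ℤP.*-monoʳ-≤-nonNeg s {{ℤ.nonNegative (ℤP.<⇒≤ 0<s)}}
  ≥⇒Within (inj₂ s<0) = ℤP.*-monoʳ-≤-nonPos s {{ℤ.nonPositive (ℤP.<⇒≤ s<0)}}

  EndpointsWithin : UnitEdge → Pt → Bool → Set
  EndpointsWithin ed c ω = ∀ x → x ≢ dir ed → Within ω (posCentroid ed x + + 1) (c x) × Within ω (posCentroid ed x - + 2 * + 1) (c x)

  initialState : ∀ r ed {c ω} → InteriorEdge (suc r ℕ.+ e) ed → (∀ x → OnLayer s (c x)) → c (dir ed) ≡ lvl (n ed (dir ed)) →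
    sum3 c ≡ + 3 * s * signOf ω → EndpointsWithin ed c ω →
    FoldState (r ℕ.+ e) (posCentroid ed) (negCentroid ed) (dir ed) (lvl (n ed (dir ed))) (+ 1) c ω
  initialState r ed (P-in , N-in) onLayer along Σ≡ within = record
    { p-inside = P-in
    ; q-inside = N-in
    ; p-d = posCentroid-across ed
    ; q-d = negCentroid-across ed
    ; q-other = negCentroid-other ed
    ; σ-unit = inj₁ refl
    ; p-offGrid = posCentroid-offGrid ed
    ; q-offGrid = negCentroid-offGrid ed
    ; p-sum = posCentroid-sum ed
    ; q-sum = negCentroid-sum ed
    ; c-onLayer = onLayer
    ; c-d = along
    ; c-sum = Σ≡
    ; edge-within = within
    }

  edge-colour : ∀ a K ed {c ω} → InteriorEdge K ed → (∀ x → OnLayer s (c x)) → c (dir ed) ≡ lvl (n ed (dir ed)) →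
    sum3 c ≡ + 3 * s * signOf ω → EndpointsWithin ed c ω → colourIn a K ed ≡ just (foldColour (a (suc e)) ω)
  edge-colour a K ed {c} {ω} interior onLayer along Σ≡ within
    with ≤⇒∃suc+ (interior⇒layer≤K K ed interior (subst (OnLayer s) along (onLayer (dir ed))))
  ... | r , refl = trans (crease-fromState a r false (initialState r ed interior onLayer along Σ≡ within))
                     (cong (λ b → just (foldColour (a (suc e)) b)) (Boolₚ.xor-identityʳ ω))

  layerColoured : ∀ a (sg : Sign s) → LayerColoured a (suc e) (foldColour (a (suc e)) (orientation sg)) (foldColour (a (suc e)) (not (orientation sg)))
  layerColoured a sg = onPositive , onNegative
    where
    onPositive : ∀ K ed → InteriorEdge K ed → OnPosTriOfLayer (suc e) ed → colourIn a K ed ≡ just (foldColour (a (suc e)) (orientation sg))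
    onPositive K ed interior (c , T , along , bound) =
      edge-colour a K ed interior (sides-onLayer (PosTriangle.sides T)) along (posTriangle-sum T sg) within
      where
      within : EndpointsWithin ed c (orientation sg)
      within x x≢d = map (≤⇒Within sg) (≤⇒Within sg) (edgeEndpoints ed ℤ._≤_ bound x x≢d)
    onNegative : ∀ K ed → InteriorEdge K ed → OnNegTriOfLayer (suc e) ed → colourIn a K ed ≡ just (foldColour (a (suc e)) (not (orientation sg)))
    onNegative K ed interior (c , T , along , bound) =
      edge-colour a K ed interior (sides-onLayer (NegTriangle.sides T)) along (negTriangle-sum T sg) within
      where
      within : EndpointsWithin ed c (not (orientation sg))
      within x x≢d = map (≥⇒Within sg) (≥⇒Within sg) (edgeEndpoints ed (λ v w → w ℤ.≤ v) bound x x≢d)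

Odd⇒0<negTwoPow : ∀ e → Odd (suc e) → + 0 < negTwoPow e
Odd⇒0<negTwoPow e (m , suc-e≡) = subst (λ j → + 0 < negTwoPow j) (sym (ℕP.suc-injective suc-e≡)) (negTwoPow-even m)

Even⇒negTwoPow<0 : ∀ e → Even (suc e) → negTwoPow e < + 0
Even⇒negTwoPow<0 e (suc m , suc-e≡) =
  subst (λ j → negTwoPow j < + 0) (sym (trans (ℕP.suc-injective suc-e≡) (ℕP.+-suc m (m ℕ.+ 0)))) (negTwoPow-odd m)

lemma3p3 : (a : ℕ → Fold) (k : ℕ) → 1 ≤ k →
    (((Odd k × a k ≡ up) ⊎ (Even k × a k ≡ down)) → LayerColoured a k red blue) ×
    (((Odd k × a k ≡ down) ⊎ (Even k × a k ≡ up)) → LayerColoured a k blue red)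
lemma3p3 a (suc e) _ = positiveRed , positiveBlue
  where
  open Layer e
  coloured : ∀ sg f → a (suc e) ≡ f → LayerColoured a (suc e) (foldColour f (orientation sg)) (foldColour f (not (orientation sg)))
  coloured sg f refl = layerColoured a sg
  positiveRed : ((Odd (suc e) × a (suc e) ≡ up) ⊎ (Even (suc e) × a (suc e) ≡ down)) → LayerColoured a (suc e) red blue
  positiveRed (inj₁ (odd , a≡up)) = coloured (inj₁ (Odd⇒0<negTwoPow e odd)) up a≡up
  positiveRed (inj₂ (even , a≡down)) = coloured (inj₂ (Even⇒negTwoPow<0 e even)) down a≡down
  positiveBlue : ((Odd (suc e) × a (suc e) ≡ down) ⊎ (Even (suc e) × a (suc e) ≡ up)) → LayerColoured a (suc e) blue red
  positiveBlue (inj₁ (odd , a≡down)) = coloured (inj₁ (Odd⇒0<negTwoPow e odd)) down a≡down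
  positiveBlue (inj₂ (even , a≡up)) = coloured (inj₂ (Even⇒negTwoPow<0 e even)) up a≡up
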